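{- Let $1\le d\le \ell\le k-1$ be integers and put $t=k-d$. Then, for $n$ divisible by $k-\ell$, \[ h_d^{\ell}(k,n) \ge \left( 1 - b_{t, k-\ell}\, 2^{ -t} + o(1) \right)\binom nt, \] where $b_{t,k-\ell}$ is the largest sum of $k-\ell$ consecutive binomial coefficients from $\binom t0,\dots,\binom tt$, and $o(1)$ denotes a quantity tending to $0$ as $n\to\infty$.
   Context: A $k$-uniform hypergraph ($k$-graph) $H$ consists of a vertex set $V$ and an edge set $E\subseteq\binom{V}{k}$. For a set $S$ of $d$ vertices ($1\le d\le k-1$), $\deg_H(S)$ is the number of edges containing $S$, and the minimum $d$-degree $\delta_d(H)$ is the minimum of $\deg_H(S)$ over all $d$-vertex sets $S$. For $1\le \ell\le k-1$, a $k$-graph is an $\ell$-cycle if its vertices can be ordered cyclically so that each edge consists of $k$ consecutive vertices and every two consecutive edges (in the natural order of the edges) share exactly $\ell$ vertices. A Hamilton $\ell$-cycle of $H$ is a spanning subhypergraph that is an $\ell$-cycle. For $n$ divisible by $k-\ell$, $h_d^\ell(k,n)$ is the smallest integer $h$ such that every $n$-vertex $k$-graph $H$ with $\delta_d(H)\ge h$ contains a Hamilton $\ell$-cycle. -}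

module Defs where

open import Data.Nat using (ℕ; zero; suc; _+_; _*_; _∸_; _≤_; _≟_; _⊔_)
open import Data.Nat.DivMod using (_mod_)
open import Data.Nat.Combinatorics using (_C_)
open import Data.Nat.ListAction using (sum)
open import Data.Fin using (Fin)
open import Data.Fin.Subset using (Subset; ∣_∣; _⊆_; ⁅_⁆; ⋃; ⊥; _∩_; inside; outside)
open import Data.Fin.Subset.Properties using (_⊆?_)
open import Data.Bool using (Bool; true; _∧_)
open import Data.List using (List; []; _∷_; _++_; map; upTo; foldr; length; filterᵇ)
open import Data.Vec using ([]; _∷_)
open import Data.Product using (Σ; _×_)
open import Function.Definitions using (Injective)
open import Relation.Binary.PropositionalEquality using (_≡_)
open import Relation.Nullary.Decidable using (⌊_⌋)

-- A k-graph on the vertex set Fin n.  It is given by an indicator on subsets;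
-- its edges are exactly the subsets of size k on which the indicator is true
-- (values on subsets of other sizes are ignored).
KGraph : ℕ → Set
KGraph n = Subset n → Bool

IsEdge : ∀ {n} → ℕ → KGraph n → Subset n → Set
IsEdge k H e = (∣ e ∣ ≡ k) × (H e ≡ true)

allSubsets : (n : ℕ) → List (Subset n)
allSubsets zero = [] ∷ []
allSubsets (suc n) = map (inside ∷_) (allSubsets n) ++ map (outside ∷_) (allSubsets n)

deg : ∀ {n} → ℕ → KGraph n → Subset n → ℕ
deg {n} k H S = length (filterᵇ (λ T → ⌊ ∣ T ∣ ≟ k ⌋ ∧ ⌊ S ⊆? T ⌋ ∧ H T) (allSubsets n))

MinDegAtLeast : ∀ {n} → ℕ → ℕ → KGraph n → ℕ → Set
MinDegAtLeast k d H h = ∀ S → ∣ S ∣ ≡ d → h ≤ deg k H S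

window : ∀ {n} → (Fin n → Fin n) → ℕ → ℕ → Subset n
window {zero} σ s len = []
window {suc n} σ s len = ⋃ (map (λ j → ⁅ σ ((s + j) mod suc n) ⁆) (upTo len))

HamiltonCycle : ∀ {n} → ℕ → ℕ → KGraph n → Set
HamiltonCycle {n} k ℓ H =
  Σ (Fin n → Fin n) λ σ → Injective _≡_ _≡_ σ ×
  Σ ℕ λ m → (m * (k ∸ ℓ) ≡ n) ×
    (∀ i → suc i ≤ m →
       IsEdge k H (window σ (i * (k ∸ ℓ)) k) ×
       (∣ window σ (i * (k ∸ ℓ)) k ∩ window σ (suc i * (k ∸ ℓ)) k ∣ ≡ ℓ))

consecSum : ℕ → ℕ → ℕ → ℕ
consecSum t s i = sum (map (λ j → t C (i + j)) (upTo s))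

b : ℕ → ℕ → ℕ
b t s = foldr _⊔_ 0 (map (consecSum t s) (upTo (suc (t ∸ s))))

-- Split the vertices into two halves A and ∁ A, put s = k - ℓ, t = k - d, q = ⌊k / s⌋, and let H consist
-- of the k-sets whose number of vertices in A avoids the s consecutive values ending at ⌊(q + 1) s / 2⌋.
-- The edges of an ℓ-cycle are windows of the cyclic order shifted by s, so along the cycle their numbers of
-- A-vertices change by at most s per step and never cross the gap: all edges lie above it or all below it,
-- and double counting against ∣ A ∣ ≈ ∣ ∁ A ∣ ≈ n / 2 rules out both.  A d-set S misses only those k-sets
-- T ⊇ S whose number of new A-vertices lies in s consecutive values x, at most
-- Σ C(∣A ∖ S∣, x) C(∣∁ A ∖ S∣, t - x) ≤ b_{t,s} (n + 1) ^ t / (2 ^ t t!) of them, which gives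
-- δ_d(H) ≥ (1 - b_{t,s} 2 ^ -t - o(1)) C(n, t).

module Submission where

open import Defs
open import Data.Nat using (ℕ; suc; _+_; _*_; _∸_; _^_; _≤_; _<_; _≤?_; _!; z≤n; s≤s)
open import Data.Nat.Properties using (1≤n!; m^n>0; m+n≤o⇒n≤o)
open import Data.Nat.Divisibility using (_∣_)
open import Data.Nat.Combinatorics using (_C_)
open import Data.Fin using (Fin)
open import Data.Product using (Σ; _,_)
open import Data.Empty using (⊥-elim)
open import Relation.Nullary using (yes; no)

module BoundedSums where

  open import Data.Nat
  open import Data.Nat.Properties
  open import Data.Nat.ListAction using (sum)
  open import Data.List using (map; upTo; applyUpTo)
  open import Data.Product using (_,_)
  open import Data.Fin using (Fin; zero; suc)
  open import Function using (_∘_)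
  open import Relation.Binary.PropositionalEquality
  open import Relation.Nullary.Negation using (contradiction)
  open import Algebra.Properties.CommutativeSemigroup +-commutativeSemigroup using (interchange; x∙yz≈xz∙y; xy∙z≈xz∙y)

  ∑< : ℕ → (ℕ → ℕ) → ℕ
  ∑< zero    f = 0
  ∑< (suc n) f = f 0 + ∑< n (f ∘ suc)

  ∑<-cong : ∀ n {f g : ℕ → ℕ} → (∀ i → i < n → f i ≡ g i) → ∑< n f ≡ ∑< n g
  ∑<-cong zero    eq = refl
  ∑<-cong (suc n) eq = cong₂ _+_ (eq 0 z<s) (∑<-cong n (λ i i<n → eq (suc i) (s<s i<n)))

  ∑<-mono-≤ : ∀ n {f g : ℕ → ℕ} → (∀ i → i < n → f i ≤ g i) → ∑< n f ≤ ∑< n g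
  ∑<-mono-≤ zero    le = z≤n
  ∑<-mono-≤ (suc n) le = +-mono-≤ (le 0 z<s) (∑<-mono-≤ n (λ i i<n → le (suc i) (s<s i<n)))

  ∑<-distrib-+ : ∀ n (f g : ℕ → ℕ) → ∑< n (λ i → f i + g i) ≡ ∑< n f + ∑< n g
  ∑<-distrib-+ zero    f g = refl
  ∑<-distrib-+ (suc n) f g rewrite ∑<-distrib-+ n (f ∘ suc) (g ∘ suc) = interchange (f 0) (g 0) _ _

  ∑<-distribˡ-* : ∀ n c (f : ℕ → ℕ) → ∑< n (λ i → c * f i) ≡ c * ∑< n f
  ∑<-distribˡ-* zero    c f = sym (*-zeroʳ c)
  ∑<-distribˡ-* (suc n) c f rewrite ∑<-distribˡ-* n c (f ∘ suc) = sym (*-distribˡ-+ c (f 0) _)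

  ∑<-const : ∀ n c → ∑< n (λ _ → c) ≡ n * c
  ∑<-const zero    c = refl
  ∑<-const (suc n) c = cong (c +_) (∑<-const n c)

  ∑<-+ : ∀ a b (f : ℕ → ℕ) → ∑< (a + b) f ≡ ∑< a f + ∑< b (λ i → f (a + i))
  ∑<-+ zero    b f = refl
  ∑<-+ (suc a) b f rewrite ∑<-+ a b (f ∘ suc) = sym (+-assoc (f 0) _ _)

  ∑<-suc : ∀ n (f : ℕ → ℕ) → ∑< (suc n) f ≡ ∑< n f + f n
  ∑<-suc n f = begin
    ∑< (suc n) f                 ≡⟨ cong (λ m → ∑< m f) (+-comm 1 n) ⟩
    ∑< (n + 1) f                 ≡⟨ ∑<-+ n 1 f ⟩
    ∑< n f + (f (n + 0) + 0)     ≡⟨ cong (∑< n f +_) (trans (+-identityʳ _) (cong f (+-identityʳ n))) ⟩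
    ∑< n f + f n                 ∎
    where open ≡-Reasoning

  ∑<-monoˡ-≤ : ∀ {a b} (f : ℕ → ℕ) → a ≤ b → ∑< a f ≤ ∑< b f
  ∑<-monoˡ-≤ {a} f a≤b with m≤n⇒∃[o]m+o≡n a≤b
  ... | o , refl = subst (∑< a f ≤_) (sym (∑<-+ a o f)) (m≤m+n _ _)

  term≤∑< : ∀ n (f : ℕ → ℕ) {j} → j < n → f j ≤ ∑< n f
  term≤∑< (suc n) f {zero}  _         = m≤m+n (f 0) _
  term≤∑< (suc n) f {suc j} (s≤s j<n) = ≤-trans (term≤∑< n (f ∘ suc) j<n) (m≤n+m _ (f 0))

  ∑<-zero : ∀ n (f : ℕ → ℕ) → (∀ i → i < n → f i ≡ 0) → ∑< n f ≡ 0
  ∑<-zero zero    f f≡0 = refl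
  ∑<-zero (suc n) f f≡0 rewrite f≡0 0 z<s = ∑<-zero n (f ∘ suc) (λ i i<n → f≡0 (suc i) (s<s i<n))

  ∑<-≤-length : ∀ n (f : ℕ → ℕ) → (∀ i → f i ≤ 1) → ∑< n f ≤ n
  ∑<-≤-length zero    f f≤1 = z≤n
  ∑<-≤-length (suc n) f f≤1 = +-mono-≤ (f≤1 0) (∑<-≤-length n (f ∘ suc) (f≤1 ∘ suc))

  ∑<-≤1 : ∀ n (f : ℕ → ℕ) → (∀ i → f i ≤ 1) →
    (∀ i j → i < n → j < n → f i ≡ 1 → f j ≡ 1 → i ≡ j) → ∑< n f ≤ 1
  ∑<-≤1 zero    f f≤1 unique = z≤n
  ∑<-≤1 (suc n) f f≤1 unique rewrite ∑<-suc n f with f n in fn | f≤1 n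
  ... | zero  | _ = subst (_≤ 1) (sym (+-identityʳ _))
        (∑<-≤1 n f f≤1 (λ i j i<n j<n → unique i j (m≤n⇒m≤1+n i<n) (m≤n⇒m≤1+n j<n)))
  ... | suc zero | _ = ≤-reflexive (cong (_+ 1) (∑<-zero n f below))
    where
    below : ∀ i → i < n → f i ≡ 0
    below i i<n with f i in fi | f≤1 i
    ... | zero     | _ = refl
    ... | suc zero | _ = contradiction (unique i n (m≤n⇒m≤1+n i<n) ≤-refl fi fn) (<⇒≢ i<n)
    ... | suc (suc _) | s≤s ()
  ... | suc (suc _) | s≤s ()

  ∑<-reverse : ∀ n (f : ℕ → ℕ) → ∑< n f ≡ ∑< n (λ i → f (n ∸ suc i))
  ∑<-reverse zero    f = refl
  ∑<-reverse (suc n) f = begin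
    f 0 + ∑< n (f ∘ suc)                                   ≡⟨ cong (f 0 +_) (∑<-reverse n (f ∘ suc)) ⟩
    f 0 + ∑< n (λ i → f (suc (n ∸ suc i)))                 ≡⟨ +-comm (f 0) _ ⟩
    ∑< n (λ i → f (suc (n ∸ suc i))) + f 0                 ≡⟨ cong₂ _+_ (∑<-cong n (λ i i<n → cong f (sym (+-∸-assoc 1 i<n))))
                                                                       (cong f (sym (n∸n≡0 n))) ⟩
    ∑< n (λ i → f (suc n ∸ suc i)) + f (suc n ∸ suc n)     ≡⟨ sym (∑<-suc n (λ i → f (suc n ∸ suc i))) ⟩
    ∑< (suc n) (λ i → f (suc n ∸ suc i))                   ∎
    where open ≡-Reasoning

  ∑<-shift-periodic : ∀ n (g : ℕ → ℕ) → (∀ i → g (i + n) ≡ g i) → ∀ a → ∑< n (λ i → g (i + a)) ≡ ∑< n g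
  ∑<-shift-periodic n g per zero    = ∑<-cong n (λ i _ → cong g (+-identityʳ i))
  ∑<-shift-periodic n g per (suc a) = +-cancelʳ-≡ (g a) _ _ (begin
    ∑< n (λ i → g (i + suc a)) + g a      ≡⟨ +-comm _ (g a) ⟩
    g a + ∑< n (λ i → g (i + suc a))      ≡⟨ cong (g a +_) (∑<-cong n (λ i _ → cong g (+-suc i a))) ⟩
    ∑< (suc n) (λ i → g (i + a))          ≡⟨ ∑<-suc n (λ i → g (i + a)) ⟩
    ∑< n (λ i → g (i + a)) + g (n + a)    ≡⟨ cong₂ _+_ (∑<-shift-periodic n g per a) (trans (cong g (+-comm n a)) (per a)) ⟩
    ∑< n g + g a                          ∎)
    where open ≡-Reasoning

  ∑<-blocks : ∀ m s (g : ℕ → ℕ) → ∑< m (λ i → ∑< s (λ r → g (i * s + r))) ≡ ∑< (m * s) g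
  ∑<-blocks zero    s g = refl
  ∑<-blocks (suc m) s g = begin
    ∑< s (λ r → g (0 * s + r)) + ∑< m (λ i → ∑< s (λ r → g (suc i * s + r)))
      ≡⟨ cong (∑< s g +_) (∑<-cong m (λ i _ → ∑<-cong s (λ r _ → cong g (+-assoc s (i * s) r)))) ⟩
    ∑< s g + ∑< m (λ i → ∑< s (λ r → g (s + (i * s + r))))
      ≡⟨ cong (∑< s g +_) (∑<-blocks m s (λ p → g (s + p))) ⟩
    ∑< s g + ∑< (m * s) (λ p → g (s + p))
      ≡⟨ sym (∑<-+ s (m * s) g) ⟩
    ∑< (suc m * s) g
      ∎
    where open ≡-Reasoning

  -- Each point of a period is covered by exactly c of the m windows.
  ∑<-windows-periodic : ∀ m s c (g : ℕ → ℕ) → (∀ p → g (p + m * s) ≡ g p) →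
    ∑< m (λ i → ∑< (c * s) (λ j → g (i * s + j))) ≡ c * ∑< (m * s) g
  ∑<-windows-periodic m s zero    g per = ∑<-zero m _ (λ _ _ → refl)
  ∑<-windows-periodic m s (suc c) g per = begin
    ∑< m (λ i → ∑< (s + c * s) (λ j → g (i * s + j)))
      ≡⟨ ∑<-cong m (λ i _ → ∑<-+ s (c * s) _) ⟩
    ∑< m (λ i → ∑< s (λ j → g (i * s + j)) + ∑< (c * s) (λ j → g (i * s + (s + j))))
      ≡⟨ ∑<-distrib-+ m _ _ ⟩
    ∑< m (λ i → ∑< s (λ j → g (i * s + j))) + ∑< m (λ i → ∑< (c * s) (λ j → g (i * s + (s + j))))
      ≡⟨ cong₂ _+_ (∑<-blocks m s g) shifted ⟩
    ∑< (m * s) g + c * ∑< (m * s) (λ p → g (p + s))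
      ≡⟨ cong (λ z → ∑< (m * s) g + c * z) (∑<-shift-periodic (m * s) g per s) ⟩
    ∑< (m * s) g + c * ∑< (m * s) g
      ∎
    where
    open ≡-Reasoning
    shifted : ∑< m (λ i → ∑< (c * s) (λ j → g (i * s + (s + j)))) ≡ c * ∑< (m * s) (λ p → g (p + s))
    shifted = trans (∑<-cong m (λ i _ → ∑<-cong (c * s) (λ j _ → cong g (x∙yz≈xz∙y (i * s) s j))))
      (∑<-windows-periodic m s c (λ p → g (p + s)) (λ p → trans (cong g (xy∙z≈xz∙y p (m * s) s)) (per (p + s))))

  ∑Fin : (N : ℕ) → (Fin N → ℕ) → ℕ
  ∑Fin zero g = 0
  ∑Fin (suc N) g = g zero + ∑Fin N (g ∘ suc)

  ∑Fin-cong : ∀ N (g g' : Fin N → ℕ) → (∀ y → g y ≡ g' y) → ∑Fin N g ≡ ∑Fin N g'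
  ∑Fin-cong zero g g' h = refl
  ∑Fin-cong (suc N) g g' h = cong₂ _+_ (h zero) (∑Fin-cong N (g ∘ suc) (g' ∘ suc) (h ∘ suc))

  ∑Fin-mono-≤ : ∀ N (g g' : Fin N → ℕ) → (∀ y → g y ≤ g' y) → ∑Fin N g ≤ ∑Fin N g'
  ∑Fin-mono-≤ zero g g' h = z≤n
  ∑Fin-mono-≤ (suc N) g g' h = +-mono-≤ (h zero) (∑Fin-mono-≤ N (g ∘ suc) (g' ∘ suc) (h ∘ suc))

  ∑Fin-0 : ∀ N → ∑Fin N (λ _ → 0) ≡ 0
  ∑Fin-0 zero = refl
  ∑Fin-0 (suc N) = ∑Fin-0 N

  ∑Fin-distrib-+ : ∀ N (g g' : Fin N → ℕ) → ∑Fin N (λ y → g y + g' y) ≡ ∑Fin N g + ∑Fin N g'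
  ∑Fin-distrib-+ zero g g' = refl
  ∑Fin-distrib-+ (suc N) g g' rewrite ∑Fin-distrib-+ N (g ∘ suc) (g' ∘ suc) = interchange (g zero) (g' zero) _ _

  ∑<-∑Fin-comm : ∀ n N (φ : ℕ → Fin N → ℕ) → ∑< n (λ p → ∑Fin N (φ p)) ≡ ∑Fin N (λ y → ∑< n (λ p → φ p y))
  ∑<-∑Fin-comm zero N φ = sym (∑Fin-0 N)
  ∑<-∑Fin-comm (suc n) N φ rewrite ∑<-∑Fin-comm n N (φ ∘ suc) = sym (∑Fin-distrib-+ N (φ 0) (λ y → ∑< n (λ p → φ (suc p) y)))

  sum-map-applyUpTo : ∀ n (g f : ℕ → ℕ) → sum (map g (applyUpTo f n)) ≡ ∑< n (g ∘ f)
  sum-map-applyUpTo zero    g f = refl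
  sum-map-applyUpTo (suc n) g f = cong (g (f 0) +_) (sum-map-applyUpTo n g (f ∘ suc))

  sum-map-upTo : ∀ n (g : ℕ → ℕ) → sum (map g (upTo n)) ≡ ∑< n g
  sum-map-upTo n g = sum-map-applyUpTo n g (λ i → i)

module FallingFactorial where

  open import Data.Nat
  open import Data.Nat.Properties
  open import Data.Nat.Combinatorics using (_C_; nCk≡n!/k![n-k]!; k>n⇒nCk≡0; k![n∸k]!∣n!)
  open import Data.Nat.DivMod using (m/n*n≡m)
  open import Data.Nat.Tactic.RingSolver using (solve-∀)
  open import Relation.Binary.PropositionalEquality
  open import Relation.Nullary using (yes; no)

  nCk*[k!*[n∸k]!]≡n! : ∀ n k → k ≤ n → (n C k) * (k ! * (n ∸ k) !) ≡ n !
  nCk*[k!*[n∸k]!]≡n! n k k≤n =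
    trans (cong (_* (k ! * (n ∸ k) !)) (nCk≡n!/k![n-k]! k≤n)) (m/n*n≡m (k![n∸k]!∣n! k≤n))
    where instance _ = k !* (n ∸ k) !≢0

  falling : ℕ → ℕ → ℕ
  falling n k = (n C k) * k !

  falling-suc : ∀ n k → falling (suc n) (suc k) ≡ suc n * falling n k
  falling-suc n k with k ≤? n
  ... | yes k≤n = *-cancelʳ-≡ _ _ ((n ∸ k) !) {{(n ∸ k) !≢0}} (begin
      (suc n C suc k) * (suc k !) * (n ∸ k) !         ≡⟨ *-assoc (suc n C suc k) (suc k !) _ ⟩
      (suc n C suc k) * (suc k ! * (suc n ∸ suc k) !) ≡⟨ nCk*[k!*[n∸k]!]≡n! (suc n) (suc k) (s≤s k≤n) ⟩
      suc n * n !                                     ≡⟨ cong (suc n *_) (sym (nCk*[k!*[n∸k]!]≡n! n k k≤n)) ⟩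
      suc n * ((n C k) * (k ! * (n ∸ k) !))           ≡⟨ reassoc (suc n) (n C k) (k !) ((n ∸ k) !) ⟩
      suc n * ((n C k) * k !) * (n ∸ k) !             ∎)
    where
    open ≡-Reasoning
    reassoc : ∀ a b c d → a * (b * (c * d)) ≡ a * (b * c) * d
    reassoc = solve-∀
  ... | no k≰n = begin
      (suc n C suc k) * suc k !   ≡⟨ cong (_* suc k !) (k>n⇒nCk≡0 (s≤s (≰⇒> k≰n))) ⟩
      0                           ≡⟨ sym (*-zeroʳ (suc n)) ⟩
      suc n * 0                   ≡⟨ cong (λ z → suc n * (z * k !)) (sym (k>n⇒nCk≡0 (≰⇒> k≰n))) ⟩
      suc n * ((n C k) * k !)     ∎
    where open ≡-Reasoning

  falling≤^ : ∀ n k → falling n k ≤ n ^ k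
  falling≤^ n       zero    = ≤-refl
  falling≤^ zero    (suc k) = ≤-reflexive (cong (_* suc k !) (k>n⇒nCk≡0 {0} {suc k} z<s))
  falling≤^ (suc n) (suc k) = begin
    falling (suc n) (suc k)  ≡⟨ falling-suc n k ⟩
    suc n * falling n k      ≤⟨ *-monoʳ-≤ (suc n) (≤-trans (falling≤^ n k) (^-monoˡ-≤ k (n≤1+n n))) ⟩
    suc n * suc n ^ k        ∎
    where open ≤-Reasoning

  [1+n∸k]^k≤falling : ∀ n k → (suc n ∸ k) ^ k ≤ falling n k
  [1+n∸k]^k≤falling n       zero    = ≤-refl
  [1+n∸k]^k≤falling zero    (suc k) = ≤-reflexive (cong (_^ suc k) (0∸n≡0 k))
  [1+n∸k]^k≤falling (suc n) (suc k) = begin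
    (suc n ∸ k) * (suc n ∸ k) ^ k  ≤⟨ *-monoˡ-≤ _ (m∸n≤m (suc n) k) ⟩
    suc n * (suc n ∸ k) ^ k        ≤⟨ *-monoʳ-≤ (suc n) ([1+n∸k]^k≤falling n k) ⟩
    suc n * falling n k            ≡⟨ sym (falling-suc n k) ⟩
    falling (suc n) (suc k)        ∎
    where open ≤-Reasoning

  [m*n]^o≡m^o*n^o : ∀ m n o → (m * n) ^ o ≡ m ^ o * n ^ o
  [m*n]^o≡m^o*n^o m n zero    = refl
  [m*n]^o≡m^o*n^o m n (suc o) rewrite [m*n]^o≡m^o*n^o m n o = shuffle m n (m ^ o) (n ^ o)
    where
    shuffle : ∀ a b x y → a * b * (x * y) ≡ a * x * (b * y)
    shuffle = solve-∀

  falling*2^≤ : ∀ x k N → 2 * x ≤ N → falling x k * 2 ^ k ≤ N ^ k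
  falling*2^≤ x k N 2x≤N = begin
    falling x k * 2 ^ k  ≤⟨ *-monoˡ-≤ (2 ^ k) (falling≤^ x k) ⟩
    x ^ k * 2 ^ k        ≡⟨ *-comm (x ^ k) _ ⟩
    2 ^ k * x ^ k        ≡⟨ sym ([m*n]^o≡m^o*n^o 2 x k) ⟩
    (2 * x) ^ k          ≤⟨ ^-monoˡ-≤ k 2x≤N ⟩
    N ^ k                ∎
    where open ≤-Reasoning

  [y+c]^[1+u]≤ : ∀ y c u → (y + c) ^ suc u ≤ y ^ suc u + c * suc u * (y + c) ^ u
  [y+c]^[1+u]≤ y c zero    = ≤-reflexive (linear y c)
    where
    linear : ∀ y c → (y + c) * 1 ≡ y * 1 + c * 1 * 1
    linear = solve-∀
  [y+c]^[1+u]≤ y c (suc u) = begin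
      (y + c) * (y + c) ^ suc u
    ≤⟨ *-monoʳ-≤ (y + c) ([y+c]^[1+u]≤ y c u) ⟩
      (y + c) * (y ^ suc u + c * suc u * (y + c) ^ u)
    ≡⟨ expand y c (y ^ suc u) (suc u) ((y + c) ^ u) ⟩
      y * y ^ suc u + c * y ^ suc u + c * suc u * ((y + c) * (y + c) ^ u)
    ≤⟨ +-monoˡ-≤ _ (+-monoʳ-≤ (y * y ^ suc u) (*-monoʳ-≤ c (^-monoˡ-≤ (suc u) (m≤m+n y c)))) ⟩
      y * y ^ suc u + c * (y + c) ^ suc u + c * suc u * ((y + c) * (y + c) ^ u)
    ≡⟨ collect (y * y ^ suc u) c (suc u) ((y + c) ^ suc u) ⟩
      y * y ^ suc u + c * suc (suc u) * (y + c) ^ suc u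
    ∎
    where
    open ≤-Reasoning
    expand : ∀ y c P v Q → (y + c) * (P + c * v * Q) ≡ y * P + c * P + c * v * ((y + c) * Q)
    expand = solve-∀
    collect : ∀ Y c v R → Y + c * R + c * v * R ≡ Y + c * suc v * R
    collect = solve-∀

  -- This is where the o(1) of the theorem is absorbed.
  ^-shift-≤ : ∀ K y c t → 1 ≤ t → K * c * t + c * t ≤ y + c → K * (y + c) ^ t ≤ K * y ^ t + y ^ t
  ^-shift-≤ K y c (suc u) _ large = begin
      K * (y + c) ^ suc u
    ≤⟨ *-monoʳ-≤ K mvt ⟩
      K * (y ^ suc u + c * suc u * M)
    ≡⟨ *-distribˡ-+ K (y ^ suc u) _ ⟩
      K * y ^ suc u + K * (c * suc u * M)
    ≤⟨ +-monoʳ-≤ (K * y ^ suc u) increment≤ ⟩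
      K * y ^ suc u + y ^ suc u
    ∎
    where
    open ≤-Reasoning
    M : ℕ
    M = (y + c) ^ u
    mvt : (y + c) ^ suc u ≤ y ^ suc u + c * suc u * M
    mvt = [y+c]^[1+u]≤ y c u
    increment≤ : K * (c * suc u * M) ≤ y ^ suc u
    increment≤ = +-cancelʳ-≤ (c * suc u * M) _ _ (begin
        K * (c * suc u * M) + c * suc u * M   ≡⟨ factor K c (suc u) M ⟩
        (K * c * suc u + c * suc u) * M       ≤⟨ *-monoˡ-≤ M large ⟩
        (y + c) * M                           ≤⟨ mvt ⟩
        y ^ suc u + c * suc u * M             ∎)
      where
      factor : ∀ K c v M → K * (c * v * M) + c * v * M ≡ (K * c * v + c * v) * M
      factor = solve-∀

module SubsetCounting where

  open import Data.Nat
  open import Data.Nat.Properties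
  open import Data.Nat.Combinatorics using (_C_; nCk+nC[k+1]≡[n+1]C[k+1])
  open import Data.Bool using (Bool; true; false; _∧_)
  open import Data.Bool.Properties using (∧-zeroʳ)
  open import Data.List using (List; []; _∷_; _++_; map; length; filterᵇ)
  open import Data.Vec using ([]; _∷_)
  open import Data.Fin using (Fin; zero; suc) renaming (_≟_ to _≟ᶠ_)
  open import Data.Fin.Subset using (Subset; ∣_∣; inside; outside; ⁅_⁆; ⊥; _∪_; ∁)
  open import Data.Fin.Subset.Properties using (_⊆?_; ∪-identityˡ; ∪-assoc; ∪-comm)
  open import Data.Product using (Σ; _×_; _,_)
  open import Function using (_∘_)
  open import Relation.Binary.PropositionalEquality
  open import Relation.Nullary using (yes; no)
  open import Relation.Nullary.Decidable using (does)
  open import Algebra.Properties.CommutativeSemigroup +-commutativeSemigroup using (interchange)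
  open BoundedSums

  count : ∀ {A : Set} → (A → Bool) → List A → ℕ
  count p xs = length (filterᵇ p xs)

  𝟙 : Bool → ℕ
  𝟙 true = 1
  𝟙 false = 0

  count-∷ : ∀ {A : Set} (p : A → Bool) x xs → count p (x ∷ xs) ≡ 𝟙 (p x) + count p xs
  count-∷ p x xs with p x
  ... | true = refl
  ... | false = refl

  count-++ : ∀ {A : Set} (p : A → Bool) xs ys → count p (xs ++ ys) ≡ count p xs + count p ys
  count-++ p [] ys = refl
  count-++ p (x ∷ xs) ys rewrite count-∷ p x (xs ++ ys) | count-∷ p x xs | count-++ p xs ys = sym (+-assoc (𝟙 (p x)) _ _)

  count-map : ∀ {A B : Set} (p : B → Bool) (f : A → B) xs → count p (map f xs) ≡ count (p ∘ f) xs
  count-map p f [] = refl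
  count-map p f (x ∷ xs) rewrite count-∷ p (f x) (map f xs) | count-∷ (p ∘ f) x xs | count-map p f xs = refl

  count-false : ∀ {A : Set} (xs : List A) → count (λ _ → false) xs ≡ 0
  count-false [] = refl
  count-false (x ∷ xs) = count-false xs

  count-cong : ∀ {A : Set} (p q : A → Bool) xs → (∀ x → p x ≡ q x) → count p xs ≡ count q xs
  count-cong p q [] h = refl
  count-cong p q (x ∷ xs) h rewrite count-∷ p x xs | count-∷ q x xs | h x | count-cong p q xs h = refl

  count-allSubsets : ∀ n (p : Subset (suc n) → Bool) →
    count p (allSubsets (suc n)) ≡ count (λ T → p (inside ∷ T)) (allSubsets n) + count (λ T → p (outside ∷ T)) (allSubsets n)
  count-allSubsets n p rewrite count-++ p (map (inside ∷_) (allSubsets n)) (map (outside ∷_) (allSubsets n))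
    | count-map p (inside ∷_) (allSubsets n) | count-map p (outside ∷_) (allSubsets n) = refl

  count-cover : ∀ {X : Set} (q p : X → Bool) (P : ℕ → X → Bool) s (xs : List X) →
    (∀ x → q x ≡ true → p x ≡ false → Σ ℕ λ j → j < s × P j x ≡ true) →
    count q xs ≤ count p xs + ∑< s (λ j → count (P j) xs)
  count-cover q p P s []       covered = z≤n
  count-cover q p P s (x ∷ xs) covered = begin
      count q (x ∷ xs)
    ≡⟨ count-∷ q x xs ⟩
      𝟙 (q x) + count q xs
    ≤⟨ +-mono-≤ (head (q x) (p x) refl refl) (count-cover q p P s xs covered) ⟩
      (𝟙 (p x) + ∑< s (λ j → 𝟙 (P j x))) + (count p xs + ∑< s (λ j → count (P j) xs))
    ≡⟨ interchange (𝟙 (p x)) _ _ _ ⟩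
      (𝟙 (p x) + count p xs) + (∑< s (λ j → 𝟙 (P j x)) + ∑< s (λ j → count (P j) xs))
    ≡⟨ cong₂ _+_ (sym (count-∷ p x xs)) (trans (sym (∑<-distrib-+ s _ _)) (∑<-cong s (λ j _ → sym (count-∷ (P j) x xs)))) ⟩
      count p (x ∷ xs) + ∑< s (λ j → count (P j) (x ∷ xs))
    ∎
    where
    open ≤-Reasoning
    head : ∀ b c → q x ≡ b → p x ≡ c → 𝟙 b ≤ 𝟙 c + ∑< s (λ j → 𝟙 (P j x))
    head false c    _   _   = z≤n
    head true  true _   _   = m≤m+n 1 _
    head true  false qx px with covered x qx px
    ... | j , j<s , Pjx = ≤-trans (≤-reflexive (cong 𝟙 (sym Pjx))) (term≤∑< s (λ j → 𝟙 (P j x)) j<s)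

  -- For S ⊆ T: new S T = ∣ T ∖ S ∣, split by A into newIn and newOut; free S = ∣ ∁ S ∣, split by A
  -- into freeIn and freeOut; below, inA A X = ∣ A ∩ X ∣ and card X = ∣ X ∣.  Per position with bits
  -- s, a, t of S, A, T, the indicators χ∈ and χ∉ mark t ∖ s inside and outside A.
  χ∈ : Bool → Bool → Bool → ℕ
  χ∈ false true true = 1
  χ∈ _ _ _ = 0

  χ∉ : Bool → Bool → Bool → ℕ
  χ∉ false false true = 1
  χ∉ _ _ _ = 0

  new : ∀ {n} → Subset n → Subset n → ℕ
  new [] [] = 0
  new (s ∷ S) (t ∷ T) = χ∈ s true t + new S T

  newIn : ∀ {n} → Subset n → Subset n → Subset n → ℕ
  newIn [] [] [] = 0
  newIn (s ∷ S) (a ∷ A) (t ∷ T) = χ∈ s a t + newIn S A T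

  newOut : ∀ {n} → Subset n → Subset n → Subset n → ℕ
  newOut [] [] [] = 0
  newOut (s ∷ S) (a ∷ A) (t ∷ T) = χ∉ s a t + newOut S A T

  free : ∀ {n} → Subset n → ℕ
  free [] = 0
  free (s ∷ S) = χ∈ s true true + free S

  freeIn : ∀ {n} → Subset n → Subset n → ℕ
  freeIn [] [] = 0
  freeIn (s ∷ S) (a ∷ A) = χ∈ s a true + freeIn S A

  freeOut : ∀ {n} → Subset n → Subset n → ℕ
  freeOut [] [] = 0
  freeOut (s ∷ S) (a ∷ A) = χ∉ s a true + freeOut S A

  infix 7 _⊆ᵇ_
  _⊆ᵇ_ : ∀ {n} → Subset n → Subset n → Bool
  S ⊆ᵇ T = does (S ⊆? T)

  count-⊇ : ∀ n (S : Subset n) t →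
    count (λ T → S ⊆ᵇ T ∧ (new S T ≡ᵇ t)) (allSubsets n) ≡ free S C t
  count-⊇ zero    []          zero    = refl
  count-⊇ zero    []          (suc t) = refl
  count-⊇ (suc n) (true ∷ S)  t       =
    trans (count-allSubsets n _) (trans (cong₂ _+_ (count-⊇ n S t) (count-false (allSubsets n))) (+-identityʳ _))
  count-⊇ (suc n) (false ∷ S) zero    =
    trans (count-allSubsets n _)
      (cong₂ _+_ (trans (count-cong _ _ (allSubsets n) (λ T → ∧-zeroʳ (S ⊆ᵇ T))) (count-false (allSubsets n)))
                 (count-⊇ n S zero))
  count-⊇ (suc n) (false ∷ S) (suc t) =
    trans (count-allSubsets n _)
      (trans (cong₂ _+_ (count-⊇ n S t) (count-⊇ n S (suc t))) (nCk+nC[k+1]≡[n+1]C[k+1] (free S) t))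

  count-⊇-by-A : ∀ n (S A : Subset n) x y →
    count (λ T → S ⊆ᵇ T ∧ ((newIn S A T ≡ᵇ x) ∧ (newOut S A T ≡ᵇ y))) (allSubsets n) ≡ (freeIn S A C x) * (freeOut S A C y)
  count-⊇-by-A zero    []          []          zero    zero    = refl
  count-⊇-by-A zero    []          []          zero    (suc y) = refl
  count-⊇-by-A zero    []          []          (suc x) y       = refl
  count-⊇-by-A (suc n) (true ∷ S)  (a ∷ A)     x       y       =
    trans (count-allSubsets n _) (trans (cong₂ _+_ (count-⊇-by-A n S A x y) (count-false (allSubsets n))) (+-identityʳ _))
  count-⊇-by-A (suc n) (false ∷ S) (true ∷ A)  zero    y       =
    trans (count-allSubsets n _)
      (cong₂ _+_ (trans (count-cong _ _ (allSubsets n) (λ T → ∧-zeroʳ (S ⊆ᵇ T))) (count-false (allSubsets n)))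
                 (count-⊇-by-A n S A zero y))
  count-⊇-by-A (suc n) (false ∷ S) (true ∷ A)  (suc x) y       =
    trans (count-allSubsets n _) (trans (cong₂ _+_ (count-⊇-by-A n S A x y) (count-⊇-by-A n S A (suc x) y))
      (trans (sym (*-distribʳ-+ (freeOut S A C y) (freeIn S A C x) _))
             (cong (_* (freeOut S A C y)) (nCk+nC[k+1]≡[n+1]C[k+1] (freeIn S A) x))))
  count-⊇-by-A (suc n) (false ∷ S) (false ∷ A) x       zero    =
    trans (count-allSubsets n _)
      (cong₂ _+_ (trans (count-cong _ _ (allSubsets n) (λ T → ∧∧false (S ⊆ᵇ T) (newIn S A T ≡ᵇ x))) (count-false (allSubsets n)))
                 (count-⊇-by-A n S A x zero))
    where
    ∧∧false : ∀ b c → b ∧ (c ∧ false) ≡ false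
    ∧∧false b c = trans (cong (b ∧_) (∧-zeroʳ c)) (∧-zeroʳ b)
  count-⊇-by-A (suc n) (false ∷ S) (false ∷ A) x       (suc y) =
    trans (count-allSubsets n _) (trans (cong₂ _+_ (count-⊇-by-A n S A x y) (count-⊇-by-A n S A x (suc y)))
      (trans (sym (*-distribˡ-+ (freeIn S A C x) (freeOut S A C y) _))
             (cong ((freeIn S A C x) *_) (nCk+nC[k+1]≡[n+1]C[k+1] (freeOut S A) y))))

  inA : ∀ {n} → Subset n → Subset n → ℕ
  inA [] [] = 0
  inA (a ∷ A) (t ∷ T) = χ∈ false a t + inA A T

  card : ∀ {n} → Subset n → ℕ
  card [] = 0
  card (a ∷ A) = χ∈ false a true + card A

  ∣∣≡card : ∀ {n} (S : Subset n) → ∣ S ∣ ≡ card S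
  ∣∣≡card [] = refl
  ∣∣≡card (true ∷ S) = cong suc (∣∣≡card S)
  ∣∣≡card (false ∷ S) = ∣∣≡card S

  card+free≡n : ∀ {n} (S : Subset n) → card S + free S ≡ n
  card+free≡n [] = refl
  card+free≡n (true ∷ S) = cong suc (card+free≡n S)
  card+free≡n (false ∷ S) = trans (+-suc (card S) (free S)) (cong suc (card+free≡n S))

  freeIn≤card : ∀ {n} (S A : Subset n) → freeIn S A ≤ card A
  freeIn≤card [] [] = z≤n
  freeIn≤card (true ∷ S) (true ∷ A) = m≤n⇒m≤1+n (freeIn≤card S A)
  freeIn≤card (true ∷ S) (false ∷ A) = freeIn≤card S A
  freeIn≤card (false ∷ S) (true ∷ A) = s≤s (freeIn≤card S A)
  freeIn≤card (false ∷ S) (false ∷ A) = freeIn≤card S A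

  freeOut≤card∁ : ∀ {n} (S A : Subset n) → freeOut S A ≤ card (∁ A)
  freeOut≤card∁ [] [] = z≤n
  freeOut≤card∁ (true ∷ S) (true ∷ A) = freeOut≤card∁ S A
  freeOut≤card∁ (true ∷ S) (false ∷ A) = m≤n⇒m≤1+n (freeOut≤card∁ S A)
  freeOut≤card∁ (false ∷ S) (true ∷ A) = freeOut≤card∁ S A
  freeOut≤card∁ (false ∷ S) (false ∷ A) = s≤s (freeOut≤card∁ S A)

  card-⊆ : ∀ {n} (S T : Subset n) → S ⊆ᵇ T ≡ true → card T ≡ card S + new S T
  card-⊆ [] [] h = refl
  card-⊆ (true ∷ S) (true ∷ T) h = cong suc (card-⊆ S T h)
  card-⊆ (true ∷ S) (false ∷ T) ()
  card-⊆ (false ∷ S) (true ∷ T) h = trans (cong suc (card-⊆ S T h)) (sym (+-suc (card S) (new S T)))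
  card-⊆ (false ∷ S) (false ∷ T) h = card-⊆ S T h

  new≡newIn+newOut : ∀ {n} (S A T : Subset n) → new S T ≡ newIn S A T + newOut S A T
  new≡newIn+newOut [] [] [] = refl
  new≡newIn+newOut (true ∷ S) (a ∷ A) (true ∷ T) = lem a
    where
    lem : ∀ a → new S T ≡ χ∈ true a true + newIn S A T + (χ∉ true a true + newOut S A T)
    lem true = new≡newIn+newOut S A T
    lem false = new≡newIn+newOut S A T
  new≡newIn+newOut (true ∷ S) (a ∷ A) (false ∷ T) = lem a
    where
    lem : ∀ a → new S T ≡ χ∈ true a false + newIn S A T + (χ∉ true a false + newOut S A T)
    lem true = new≡newIn+newOut S A T
    lem false = new≡newIn+newOut S A T
  new≡newIn+newOut (false ∷ S) (true ∷ A) (true ∷ T) = cong suc (new≡newIn+newOut S A T)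
  new≡newIn+newOut (false ∷ S) (false ∷ A) (true ∷ T) = trans (cong suc (new≡newIn+newOut S A T)) (sym (+-suc (newIn S A T) (newOut S A T)))
  new≡newIn+newOut (false ∷ S) (true ∷ A) (false ∷ T) = new≡newIn+newOut S A T
  new≡newIn+newOut (false ∷ S) (false ∷ A) (false ∷ T) = new≡newIn+newOut S A T

  inA-⊆ : ∀ {n} (S A T : Subset n) → S ⊆ᵇ T ≡ true → inA A T ≡ inA A S + newIn S A T
  inA-⊆ [] [] [] h = refl
  inA-⊆ (true ∷ S) (true ∷ A) (true ∷ T) h = cong suc (inA-⊆ S A T h)
  inA-⊆ (true ∷ S) (false ∷ A) (true ∷ T) h = inA-⊆ S A T h
  inA-⊆ (true ∷ S) (a ∷ A) (false ∷ T) ()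
  inA-⊆ (false ∷ S) (true ∷ A) (true ∷ T) h = trans (cong suc (inA-⊆ S A T h)) (sym (+-suc (inA A S) (newIn S A T)))
  inA-⊆ (false ∷ S) (false ∷ A) (true ∷ T) h = inA-⊆ S A T h
  inA-⊆ (false ∷ S) (true ∷ A) (false ∷ T) h = inA-⊆ S A T h
  inA-⊆ (false ∷ S) (false ∷ A) (false ∷ T) h = inA-⊆ S A T h

  inA-⊥ : ∀ {n} (A : Subset n) → inA A ⊥ ≡ 0
  inA-⊥ [] = refl
  inA-⊥ (true ∷ A) = inA-⊥ A
  inA-⊥ (false ∷ A) = inA-⊥ A

  inA-∪ : ∀ {n} (A X Y : Subset n) → inA A (X ∪ Y) ≤ inA A X + inA A Y
  inA-∪ [] [] [] = z≤n
  inA-∪ (true ∷ A) (true ∷ X) (true ∷ Y) = s≤s (≤-trans (inA-∪ A X Y) (+-monoʳ-≤ (inA A X) (n≤1+n _)))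
  inA-∪ (true ∷ A) (true ∷ X) (false ∷ Y) = s≤s (inA-∪ A X Y)
  inA-∪ (true ∷ A) (false ∷ X) (true ∷ Y) = subst (suc (inA A (X ∪ Y)) ≤_) (sym (+-suc (inA A X) (inA A Y))) (s≤s (inA-∪ A X Y))
  inA-∪ (true ∷ A) (false ∷ X) (false ∷ Y) = inA-∪ A X Y
  inA-∪ (false ∷ A) (true ∷ X) (true ∷ Y) = inA-∪ A X Y
  inA-∪ (false ∷ A) (true ∷ X) (false ∷ Y) = inA-∪ A X Y
  inA-∪ (false ∷ A) (false ∷ X) (true ∷ Y) = inA-∪ A X Y
  inA-∪ (false ∷ A) (false ∷ X) (false ∷ Y) = inA-∪ A X Y

  inA-∪ˡ : ∀ {n} (A X Y : Subset n) → inA A X ≤ inA A (X ∪ Y)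
  inA-∪ˡ [] [] [] = z≤n
  inA-∪ˡ (true ∷ A) (true ∷ X) (true ∷ Y) = s≤s (inA-∪ˡ A X Y)
  inA-∪ˡ (true ∷ A) (true ∷ X) (false ∷ Y) = s≤s (inA-∪ˡ A X Y)
  inA-∪ˡ (true ∷ A) (false ∷ X) (true ∷ Y) = m≤n⇒m≤1+n (inA-∪ˡ A X Y)
  inA-∪ˡ (true ∷ A) (false ∷ X) (false ∷ Y) = inA-∪ˡ A X Y
  inA-∪ˡ (false ∷ A) (true ∷ X) (true ∷ Y) = inA-∪ˡ A X Y
  inA-∪ˡ (false ∷ A) (true ∷ X) (false ∷ Y) = inA-∪ˡ A X Y
  inA-∪ˡ (false ∷ A) (false ∷ X) (true ∷ Y) = inA-∪ˡ A X Y
  inA-∪ˡ (false ∷ A) (false ∷ X) (false ∷ Y) = inA-∪ˡ A X Y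

  inA-∪ʳ : ∀ {n} (A X Y : Subset n) → inA A Y ≤ inA A (X ∪ Y)
  inA-∪ʳ A X Y = subst (λ Z → inA A Y ≤ inA A Z) (∪-comm Y X) (inA-∪ˡ A Y X)

  inA+inA∁≡card : ∀ {n} (A X : Subset n) → inA A X + inA (∁ A) X ≡ card X
  inA+inA∁≡card [] [] = refl
  inA+inA∁≡card (true ∷ A) (true ∷ X) = cong suc (inA+inA∁≡card A X)
  inA+inA∁≡card (false ∷ A) (true ∷ X) = trans (+-suc (inA A X) (inA (∁ A) X)) (cong suc (inA+inA∁≡card A X))
  inA+inA∁≡card (true ∷ A) (false ∷ X) = inA+inA∁≡card A X
  inA+inA∁≡card (false ∷ A) (false ∷ X) = inA+inA∁≡card A X

  inA-⁅⁆≤1 : ∀ {n} (A : Subset n) (x : Fin n) → inA A ⁅ x ⁆ ≤ 1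
  inA-⁅⁆≤1 (true ∷ A) zero = subst (_≤ 1) (sym (cong suc (inA-⊥ A))) ≤-refl
  inA-⁅⁆≤1 (false ∷ A) zero = subst (_≤ 1) (sym (inA-⊥ A)) z≤n
  inA-⁅⁆≤1 (a ∷ A) (suc x) = lem a
    where
    lem : ∀ a → χ∈ false a false + inA A ⁅ x ⁆ ≤ 1
    lem true = inA-⁅⁆≤1 A x
    lem false = inA-⁅⁆≤1 A x

  ⋃< : ∀ {n} → (ℕ → Subset n) → ℕ → Subset n
  ⋃< g zero = ⊥
  ⋃< g (suc l) = g 0 ∪ ⋃< (g ∘ suc) l

  ⋃<-cong : ∀ {n} (g g' : ℕ → Subset n) l → (∀ j → g j ≡ g' j) → ⋃< g l ≡ ⋃< g' l
  ⋃<-cong g g' zero h = refl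
  ⋃<-cong g g' (suc l) h = cong₂ _∪_ (h 0) (⋃<-cong (g ∘ suc) (g' ∘ suc) l (h ∘ suc))

  ⋃<-+ : ∀ {n} (g : ℕ → Subset n) a b → ⋃< g (a + b) ≡ ⋃< g a ∪ ⋃< (λ j → g (a + j)) b
  ⋃<-+ g zero b = sym (∪-identityˡ (⋃< g b))
  ⋃<-+ g (suc a) b = trans (cong (g 0 ∪_) (⋃<-+ (g ∘ suc) a b)) (sym (∪-assoc (g 0) _ _))

  inA-⋃< : ∀ {n} (A : Subset n) (g : ℕ → Subset n) l → inA A (⋃< g l) ≤ ∑< l (λ j → inA A (g j))
  inA-⋃< A g zero = ≤-reflexive (inA-⊥ A)
  inA-⋃< A g (suc l) = ≤-trans (inA-∪ A (g 0) _) (+-monoʳ-≤ (inA A (g 0)) (inA-⋃< A (g ∘ suc) l))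

  δ : ∀ {N} → Fin N → Fin N → ℕ
  δ x y = 𝟙 (does (x ≟ᶠ y))

  inA-⁅suc⁆ : ∀ {N} (a : Bool) (A : Subset N) (y : Fin N) → inA (a ∷ A) ⁅ suc y ⁆ ≡ inA A ⁅ y ⁆
  inA-⁅suc⁆ true A y = refl
  inA-⁅suc⁆ false A y = refl

  inA-⁅⁆-∑Fin : ∀ N (A : Subset N) (x : Fin N) → inA A ⁅ x ⁆ ≡ ∑Fin N (λ y → δ x y * inA A ⁅ y ⁆)
  inA-⁅⁆-∑Fin (suc N) (a ∷ A) zero    = sym (trans (cong₂ _+_ (+-identityʳ _) (∑Fin-0 N)) (+-identityʳ _))
  inA-⁅⁆-∑Fin (suc N) (a ∷ A) (suc x) =
    trans (inA-⁅suc⁆ a A x) (trans (inA-⁅⁆-∑Fin N A x) (∑Fin-cong N _ _ (λ y → cong (δ x y *_) (sym (inA-⁅suc⁆ a A y)))))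

  ∑Fin-inA-⁅⁆ : ∀ N (A : Subset N) → ∑Fin N (λ y → inA A ⁅ y ⁆) ≡ card A
  ∑Fin-inA-⁅⁆ zero [] = refl
  ∑Fin-inA-⁅⁆ (suc N) (a ∷ A) =
    cong₂ _+_ (trans (cong (χ∈ false a true +_) (inA-⊥ A)) (+-identityʳ _)) (trans (∑Fin-cong N _ _ (inA-⁅suc⁆ a A)) (∑Fin-inA-⁅⁆ N A))

  δ≤1 : ∀ {N} (x y : Fin N) → δ x y ≤ 1
  δ≤1 x y with x ≟ᶠ y
  ... | yes _ = ≤-refl
  ... | no _  = z≤n

  δ≡1⇒≡ : ∀ {N} (x y : Fin N) → δ x y ≡ 1 → x ≡ y
  δ≡1⇒≡ x y h with x ≟ᶠ y
  δ≡1⇒≡ x y _ | yes x≡y = x≡y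

  ∑<-inA-injective : ∀ n N (A : Subset N) (h : ℕ → Fin N) →
    (∀ p p' → p < n → p' < n → h p ≡ h p' → p ≡ p') →
    ∑< n (λ p → inA A ⁅ h p ⁆) ≤ card A
  ∑<-inA-injective n N A h inj = begin
      ∑< n (λ p → inA A ⁅ h p ⁆)
    ≡⟨ ∑<-cong n (λ p _ → inA-⁅⁆-∑Fin N A (h p)) ⟩
      ∑< n (λ p → ∑Fin N (λ y → δ (h p) y * inA A ⁅ y ⁆))
    ≡⟨ ∑<-∑Fin-comm n N _ ⟩
      ∑Fin N (λ y → ∑< n (λ p → δ (h p) y * inA A ⁅ y ⁆))
    ≤⟨ ∑Fin-mono-≤ N _ _ bound ⟩
      ∑Fin N (λ y → inA A ⁅ y ⁆)
    ≡⟨ ∑Fin-inA-⁅⁆ N A ⟩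
      card A
    ∎
    where
    open ≤-Reasoning
    bound : ∀ y → ∑< n (λ p → δ (h p) y * inA A ⁅ y ⁆) ≤ inA A ⁅ y ⁆
    bound y = begin
        ∑< n (λ p → δ (h p) y * inA A ⁅ y ⁆)
      ≡⟨ ∑<-cong n (λ p _ → *-comm (δ (h p) y) _) ⟩
        ∑< n (λ p → inA A ⁅ y ⁆ * δ (h p) y)
      ≡⟨ ∑<-distribˡ-* n (inA A ⁅ y ⁆) _ ⟩
        inA A ⁅ y ⁆ * ∑< n (λ p → δ (h p) y)
      ≤⟨ *-monoʳ-≤ (inA A ⁅ y ⁆) (∑<-≤1 n _ (λ p → δ≤1 (h p) y)
           (λ p p' lp lp' e e' → inj p p' lp lp' (trans (δ≡1⇒≡ _ _ e) (sym (δ≡1⇒≡ _ _ e'))))) ⟩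
        inA A ⁅ y ⁆ * 1
      ≡⟨ *-identityʳ _ ⟩
        inA A ⁅ y ⁆
      ∎

module ConsecutiveBinomials where

  open import Data.Nat
  open import Data.Nat.Properties
  open import Data.Nat.Combinatorics using (_C_; nCk≡nC[n∸k])
  open import Data.List using (map; foldr; applyUpTo)
  open import Data.Product using (_,_)
  open import Data.Sum using (inj₁; inj₂)
  open import Data.Nat.Tactic.RingSolver using (solve-∀)
  open import Relation.Binary.PropositionalEquality
  open import Function using (_∘_)
  open BoundedSums

  foldr-⊔-upper : ∀ (g f : ℕ → ℕ) m {i} → i < m → g (f i) ≤ foldr _⊔_ 0 (map g (applyUpTo f m))
  foldr-⊔-upper g f (suc m) {zero}  _         = m≤m⊔n _ _
  foldr-⊔-upper g f (suc m) {suc i} (s≤s i<m) = ≤-trans (foldr-⊔-upper g (f ∘ suc) m i<m) (m≤n⊔m (g (f 0)) _)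

  consecSum≤b : ∀ t s i → i ≤ t ∸ s → ∑< s (λ j → t C (i + j)) ≤ b t s
  consecSum≤b t s i i≤t∸s =
    subst (_≤ b t s) (sum-map-upTo s (λ j → t C (i + j))) (foldr-⊔-upper (consecSum t s) (λ j → j) (suc (t ∸ s)) (s≤s i≤t∸s))

  -- The last window may stick out by one position past t; by symmetry of binomial
  -- coefficients it has the same sum as the first window.
  window≤b : ∀ t s i → s ≤ t → i ≤ suc t ∸ s → ∑< s (λ j → t C (i + j)) ≤ b t s
  window≤b t s i s≤t i≤ with m≤n⇒m<n∨m≡n i≤
  ... | inj₁ i<  = consecSum≤b t s i (≤-pred (subst (i <_) (+-∸-assoc 1 s≤t) i<))
  ... | inj₂ refl = begin
      ∑< s (λ j → t C (suc t ∸ s + j))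
    ≡⟨ ∑<-reverse s _ ⟩
      ∑< s (λ j → t C (suc t ∸ s + (s ∸ suc j)))
    ≡⟨ ∑<-cong s (λ j j<s → trans (cong (t C_) (mirror j j<s)) (sym (nCk≡nC[n∸k] (≤-trans (<⇒≤ j<s) s≤t)))) ⟩
      ∑< s (λ j → t C (0 + j))
    ≤⟨ consecSum≤b t s 0 z≤n ⟩
      b t s
    ∎
    where
    open ≤-Reasoning
    mirror : ∀ j → j < s → suc t ∸ s + (s ∸ suc j) ≡ t ∸ j
    mirror j j<s with m≤n⇒∃[o]m+o≡n s≤t | m≤n⇒∃[o]m+o≡n j<s
    ... | w , refl | v , refl = begin-equality
        suc (suc j + v + w) ∸ (suc j + v) + (suc j + v ∸ suc j)
      ≡⟨ cong₂ _+_ (trans (cong (_∸ (suc j + v)) (sym (+-suc (suc j + v) w))) (m+n∸m≡n (suc j + v) (suc w)))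
                   (m+n∸m≡n (suc j) v) ⟩
        suc w + v
      ≡⟨ sym (m+n∸m≡n j (suc w + v)) ⟩
        j + (suc w + v) ∸ j
      ≡⟨ cong (_∸ j) (shuffle j w v) ⟩
        suc j + v + w ∸ j
      ∎
      where
      shuffle : ∀ j w v → j + (suc w + v) ≡ suc j + v + w
      shuffle = solve-∀

module GapGraph where

  open import Data.Nat
  open import Data.Nat.Properties
  open import Data.Nat.Combinatorics using (_C_)
  open import Data.Bool using (Bool; true; false; _∧_; not; if_then_else_; T)
  open import Data.Bool.Properties using (T-≡; ∧-conicalˡ; ∧-conicalʳ; not-injective)
  open import Data.Fin.Subset using (Subset; ∣_∣)
  open import Data.Fin.Subset.Properties using (_⊆?_)
  open import Data.Product using (Σ; _×_; _,_)
  open import Data.Sum using (inj₁; inj₂)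
  open import Data.Nat.Tactic.RingSolver using (solve-∀)
  open import Function.Bundles using (Equivalence)
  open import Relation.Binary.PropositionalEquality
  open import Relation.Nullary using (¬_; yes; no)
  open import Relation.Nullary.Decidable using (⌊_⌋; isYes≗does)
  open import Relation.Nullary.Negation using (contradiction)
  open import Function using (_∘_)
  open BoundedSums
  open FallingFactorial
  open SubsetCounting
  open ConsecutiveBinomials

  T⇒≡true : ∀ {b} → T b → b ≡ true
  T⇒≡true = Equivalence.to T-≡

  ≡true⇒T : ∀ {b} → b ≡ true → T b
  ≡true⇒T = Equivalence.from T-≡

  ¬T⇒≡false : ∀ {b} → ¬ T b → b ≡ false
  ¬T⇒≡false {false} _  = refl
  ¬T⇒≡false {true}  ¬T = contradiction _ ¬T

  inGap : ℕ → ℕ → ℕ → Bool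
  inGap J s a = (a <ᵇ J) ∧ (J ≤ᵇ a + s)

  gapGraph : ∀ {n} → ℕ → ℕ → Subset n → KGraph n
  gapGraph J s A T = not (inGap J s (inA A T))

  -- The x ≤ t with a + x in the gap form s consecutive values starting here, the window being clipped at t + 1.
  gapStart : ℕ → ℕ → ℕ → ℕ → ℕ
  gapStart J s a t = (J ∸ (a + s)) ⊓ (suc t ∸ s)

  gapStart-window : ∀ J s a t x → x ≤ t → s ≤ suc t → inGap J s (a + x) ≡ true →
    Σ ℕ λ j → j < s × gapStart J s a t + j ≡ x
  gapStart-window J s a t x x≤t s≤1+t a+x∈gap = x ∸ i , j<s , m+[n∸m]≡n i≤x
    where
    a+x<J : a + x < J
    a+x<J = <ᵇ⇒< _ _ (≡true⇒T (∧-conicalˡ _ _ a+x∈gap))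
    J≤a+x+s : J ≤ a + x + s
    J≤a+x+s = ≤ᵇ⇒≤ _ _ (≡true⇒T (∧-conicalʳ _ _ a+x∈gap))
    u v i : ℕ
    u = J ∸ (a + s)
    v = suc t ∸ s
    i = u ⊓ v
    i≤x : i ≤ x
    i≤x = ≤-trans (m⊓n≤m u v) (m≤n+o⇒m∸n≤o J (a + s) (≤-trans J≤a+x+s (≤-reflexive (+-assoc-comm a x s))))
      where
      +-assoc-comm : ∀ a x s → a + x + s ≡ a + s + x
      +-assoc-comm = solve-∀
    x<i+s : x < i + s
    x<i+s with ≤-total u v
    ... | inj₁ u≤v rewrite m≤n⇒m⊓n≡m u≤v = subst (x <_) (+-comm s u) (+-cancelˡ-≤ a (suc x) (s + u)
          (subst (_≤ a + (s + u)) (sym (+-suc a x)) (≤-trans a+x<J (≤-trans (m≤n+m∸n J (a + s)) (≤-reflexive (+-assoc a s u))))))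
    ... | inj₂ v≤u rewrite ⊓-comm u v | m≤n⇒m⊓n≡m v≤u | m∸n+n≡m s≤1+t = s≤s x≤t
    j<s : x ∸ i < s
    j<s = +-cancelˡ-< i (x ∸ i) s (subst (_< i + s) (sym (m+[n∸m]≡n i≤x)) x<i+s)

  typeCount : ∀ {n} → Subset n → Subset n → ℕ → ℕ → ℕ
  typeCount S A t x = if x ≤ᵇ t then (freeIn S A C x) * (freeOut S A C (t ∸ x)) else 0

  hasType : ∀ {n} → Subset n → Subset n → ℕ → ℕ → Subset n → Bool
  hasType S A t x T = (x ≤ᵇ t) ∧ (S ⊆ᵇ T ∧ ((newIn S A T ≡ᵇ x) ∧ (newOut S A T ≡ᵇ (t ∸ x))))

  typeCount-≤ : ∀ {n} (S A : Subset n) t x → x ≤ t → typeCount S A t x ≡ (freeIn S A C x) * (freeOut S A C (t ∸ x))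
  typeCount-≤ S A t x x≤t rewrite T⇒≡true (≤⇒≤ᵇ x≤t) = refl

  typeCount-≰ : ∀ {n} (S A : Subset n) t x → ¬ x ≤ t → typeCount S A t x ≡ 0
  typeCount-≰ S A t x x≰t rewrite ¬T⇒≡false (x≰t ∘ ≤ᵇ⇒≤ x t) = refl

  count-hasType : ∀ n (S A : Subset n) t x → count (hasType S A t x) (allSubsets n) ≡ typeCount S A t x
  count-hasType n S A t x with x ≤ᵇ t
  ... | true  = count-⊇-by-A n S A x (t ∸ x)
  ... | false = count-false (allSubsets n)

  nonEdge-inGap : ∀ {n} k t s J (A S T : Subset n) → k ≡ card S + t → S ⊆ᵇ T ≡ true → new S T ≡ t →
    (⌊ ∣ T ∣ ≟ k ⌋ ∧ ⌊ S ⊆? T ⌋ ∧ gapGraph J s A T) ≡ false → inGap J s (inA A S + newIn S A T) ≡ true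
  nonEdge-inGap k t s J A S T k≡∣S∣+t S⊆T new≡t nonEdge =
    subst (λ a → inGap J s a ≡ true) (inA-⊆ S A T S⊆T) (not-injective (nonEdge′ ∣T∣≡k))
    where
    ∣T∣≡k : ∣ T ∣ ≡ k
    ∣T∣≡k = trans (∣∣≡card T) (trans (card-⊆ S T S⊆T) (trans (cong (card S +_) new≡t) (sym k≡∣S∣+t)))
    nonEdge′ : ∣ T ∣ ≡ k → gapGraph J s A T ≡ false
    nonEdge′ refl rewrite isYes≗does (∣ T ∣ ≟ ∣ T ∣) | isYes≗does (S ⊆? T) | S⊆T
      | T⇒≡true (≡⇒≡ᵇ ∣ T ∣ ∣ T ∣ refl) = nonEdge

  hasType-newIn : ∀ {n} t (S A T : Subset n) → S ⊆ᵇ T ≡ true → new S T ≡ t → hasType S A t (newIn S A T) T ≡ true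
  hasType-newIn t S A T S⊆T new≡t = typed (trans (sym (new≡newIn+newOut S A T)) new≡t)
    where
    x y : ℕ
    x = newIn S A T
    y = newOut S A T
    typed : ∀ {t} → x + y ≡ t → hasType S A t x T ≡ true
    typed refl rewrite T⇒≡true (≤⇒≤ᵇ (m≤m+n x y)) | S⊆T | T⇒≡true (≡⇒≡ᵇ x x refl) | m+n∸m≡n x y
      | T⇒≡true (≡⇒≡ᵇ y y refl) = refl

  -- The k-sets T ⊇ S missing from the gap graph have one of s consecutive types.
  deg-gapGraph : ∀ n k t s J (A S : Subset n) → k ≡ card S + t → s ≤ suc t →
    free S C t ≤ deg k (gapGraph J s A) S + ∑< s (λ j → typeCount S A t (gapStart J s (inA A S) t + j))
  deg-gapGraph n k t s J A S k≡∣S∣+t s≤1+t =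
    subst₂ _≤_ (count-⊇ n S t) (cong (deg k (gapGraph J s A) S +_) (∑<-cong s (λ j _ → count-hasType n S A t (i + j))))
      (count-cover _ _ (λ j → hasType S A t (i + j)) s (allSubsets n) typed)
    where
    i : ℕ
    i = gapStart J s (inA A S) t
    typed : ∀ T → (S ⊆ᵇ T ∧ (new S T ≡ᵇ t)) ≡ true → (⌊ ∣ T ∣ ≟ k ⌋ ∧ ⌊ S ⊆? T ⌋ ∧ gapGraph J s A T) ≡ false →
      Σ ℕ λ j → j < s × hasType S A t (i + j) T ≡ true
    typed T ext nonEdge = shift (gapStart-window J s (inA A S) t (newIn S A T) x≤t s≤1+t
                                  (nonEdge-inGap k t s J A S T k≡∣S∣+t S⊆T new≡t nonEdge))
      where
      S⊆T : S ⊆ᵇ T ≡ true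
      S⊆T = ∧-conicalˡ _ _ ext
      new≡t : new S T ≡ t
      new≡t = ≡ᵇ⇒≡ _ _ (≡true⇒T (∧-conicalʳ _ _ ext))
      x≤t : newIn S A T ≤ t
      x≤t = subst (newIn S A T ≤_) (trans (sym (new≡newIn+newOut S A T)) new≡t) (m≤m+n _ _)
      shift : (Σ ℕ λ j → j < s × i + j ≡ newIn S A T) → Σ ℕ λ j → j < s × hasType S A t (i + j) T ≡ true
      shift (j , j<s , i+j≡x) = j , j<s , subst (λ x → hasType S A t x T ≡ true) (sym i+j≡x) (hasType-newIn t S A T S⊆T new≡t)

  typeCount-bound : ∀ {n} (S A : Subset n) t x N → 2 * freeIn S A ≤ N → 2 * freeOut S A ≤ N →
    typeCount S A t x * (t ! * 2 ^ t) ≤ (t C x) * N ^ t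
  typeCount-bound S A t x N 2α≤N 2β≤N with x ≤? t
  ... | no x≰t = ≤-trans (≤-reflexive (cong (_* (t ! * 2 ^ t)) (typeCount-≰ S A t x x≰t))) z≤n
  ... | yes x≤t = begin
      typeCount S A t x * (t ! * 2 ^ t)
    ≡⟨ cong (_* (t ! * 2 ^ t)) (typeCount-≤ S A t x x≤t) ⟩
      (α C x) * (β C (t ∸ x)) * (t ! * 2 ^ t)
    ≡⟨ cong (λ z → (α C x) * (β C (t ∸ x)) * (z * 2 ^ t)) (sym (nCk*[k!*[n∸k]!]≡n! t x x≤t)) ⟩
      (α C x) * (β C (t ∸ x)) * ((t C x) * (x ! * (t ∸ x) !) * 2 ^ t)
    ≡⟨ cong (λ z → (α C x) * (β C (t ∸ x)) * ((t C x) * (x ! * (t ∸ x) !) * z)) 2^t≡2^x*2^[t∸x] ⟩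
      (α C x) * (β C (t ∸ x)) * ((t C x) * (x ! * (t ∸ x) !) * (2 ^ x * 2 ^ (t ∸ x)))
    ≡⟨ regroup (α C x) (β C (t ∸ x)) (t C x) (x !) ((t ∸ x) !) (2 ^ x) (2 ^ (t ∸ x)) ⟩
      (t C x) * ((falling α x * 2 ^ x) * (falling β (t ∸ x) * 2 ^ (t ∸ x)))
    ≤⟨ *-monoʳ-≤ (t C x) (*-mono-≤ (falling*2^≤ α x N 2α≤N) (falling*2^≤ β (t ∸ x) N 2β≤N)) ⟩
      (t C x) * (N ^ x * N ^ (t ∸ x))
    ≡⟨ cong ((t C x) *_) (trans (sym (^-distribˡ-+-* N x (t ∸ x))) (cong (N ^_) (m+[n∸m]≡n x≤t))) ⟩
      (t C x) * N ^ t
    ∎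
    where
    open ≤-Reasoning
    α β : ℕ
    α = freeIn S A
    β = freeOut S A
    2^t≡2^x*2^[t∸x] : 2 ^ t ≡ 2 ^ x * 2 ^ (t ∸ x)
    2^t≡2^x*2^[t∸x] = trans (cong (2 ^_) (sym (m+[n∸m]≡n x≤t))) (^-distribˡ-+-* 2 x (t ∸ x))
    regroup : ∀ a c d e f g h → a * c * (d * (e * f) * (g * h)) ≡ d * ((a * e * g) * (c * f * h))
    regroup = solve-∀

  codegree-gapGraph : ∀ n k t s J N (A S : Subset n) → k ≡ card S + t → s ≤ t →
    2 * freeIn S A ≤ N → 2 * freeOut S A ≤ N →
    (free S C t) * (t ! * 2 ^ t) ≤ deg k (gapGraph J s A) S * (t ! * 2 ^ t) + b t s * N ^ t
  codegree-gapGraph n k t s J N A S k≡∣S∣+t s≤t 2α≤N 2β≤N = begin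
      (free S C t) * F
    ≤⟨ *-monoˡ-≤ F (deg-gapGraph n k t s J A S k≡∣S∣+t (m≤n⇒m≤1+n s≤t)) ⟩
      (deg k (gapGraph J s A) S + missing) * F
    ≡⟨ *-distribʳ-+ F (deg k (gapGraph J s A) S) missing ⟩
      deg k (gapGraph J s A) S * F + missing * F
    ≤⟨ +-monoʳ-≤ _ missing*F≤ ⟩
      deg k (gapGraph J s A) S * F + b t s * N ^ t
    ∎
    where
    open ≤-Reasoning
    F i missing : ℕ
    F = t ! * 2 ^ t
    i = gapStart J s (inA A S) t
    missing = ∑< s (λ j → typeCount S A t (i + j))
    missing*F≤ : missing * F ≤ b t s * N ^ t
    missing*F≤ = begin
        missing * F                                ≡⟨ *-comm missing F ⟩
        F * missing                                ≡⟨ sym (∑<-distribˡ-* s F _) ⟩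
        ∑< s (λ j → F * typeCount S A t (i + j))   ≤⟨ ∑<-mono-≤ s (λ j _ → subst (_≤ (t C (i + j)) * N ^ t) (*-comm _ F)
                                                                     (typeCount-bound S A t (i + j) N 2α≤N 2β≤N)) ⟩
        ∑< s (λ j → (t C (i + j)) * N ^ t)         ≡⟨ ∑<-cong s (λ j _ → *-comm (t C (i + j)) (N ^ t)) ⟩
        ∑< s (λ j → N ^ t * (t C (i + j)))         ≡⟨ ∑<-distribˡ-* s (N ^ t) _ ⟩
        N ^ t * ∑< s (λ j → t C (i + j))           ≤⟨ *-monoʳ-≤ (N ^ t) (window≤b t s i s≤t (m⊓n≤n _ _)) ⟩
        N ^ t * b t s                              ≡⟨ *-comm (N ^ t) (b t s) ⟩
        b t s * N ^ t                              ∎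

module Segments {n : ℕ} (f : ℕ → Fin n) where

  open import Data.Nat
  open import Data.Nat.Properties
  open import Data.Fin.Subset using (Subset; ⁅_⁆; _∪_)
  open import Relation.Binary.PropositionalEquality
  open BoundedSums
  open SubsetCounting

  segment : ℕ → ℕ → Subset n
  segment st len = ⋃< (λ j → ⁅ f (st + j) ⁆) len

  inA-segment : ∀ A st len → inA A (segment st len) ≤ ∑< len (λ j → inA A ⁅ f (st + j) ⁆)
  inA-segment A st len = inA-⋃< A _ len

  inA-segment≤length : ∀ A st len → inA A (segment st len) ≤ len
  inA-segment≤length A st len = ≤-trans (inA-segment A st len) (∑<-≤-length len _ (λ j → inA-⁅⁆≤1 A (f (st + j))))

  inA-segment-+ : ∀ A st l r → inA A (segment st (l + r)) ≤ ∑< l (λ j → inA A ⁅ f (st + j) ⁆) + r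
  inA-segment-+ A st l r = begin
      inA A (segment st (l + r))
    ≤⟨ inA-segment A st (l + r) ⟩
      ∑< (l + r) (λ j → inA A ⁅ f (st + j) ⁆)
    ≡⟨ ∑<-+ l r _ ⟩
      ∑< l (λ j → inA A ⁅ f (st + j) ⁆) + ∑< r (λ j → inA A ⁅ f (st + (l + j)) ⁆)
    ≤⟨ +-monoʳ-≤ _ (∑<-≤-length r _ (λ j → inA-⁅⁆≤1 A (f (st + (l + j))))) ⟩
      ∑< l (λ j → inA A ⁅ f (st + j) ⁆) + r
    ∎
    where open ≤-Reasoning

  segment-+ : ∀ st a b → segment st (a + b) ≡ segment st a ∪ segment (st + a) b
  segment-+ st a b = trans (⋃<-+ _ a b) (cong (segment st a ∪_) (⋃<-cong _ _ b (λ j → cong (λ z → ⁅ f z ⁆) (sym (+-assoc st a j)))))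

  inA-segment-slideʳ : ∀ A st s k → inA A (segment (st + s) k) ≤ inA A (segment st k) + s
  inA-segment-slideʳ A st s k = begin
      inA A (segment (st + s) k)
    ≤⟨ inA-∪ʳ A (segment st s) _ ⟩
      inA A (segment st s ∪ segment (st + s) k)
    ≡⟨ cong (inA A) (sym (segment-+ st s k)) ⟩
      inA A (segment st (s + k))
    ≡⟨ cong (λ z → inA A (segment st z)) (+-comm s k) ⟩
      inA A (segment st (k + s))
    ≡⟨ cong (inA A) (segment-+ st k s) ⟩
      inA A (segment st k ∪ segment (st + k) s)
    ≤⟨ inA-∪ A _ _ ⟩
      inA A (segment st k) + inA A (segment (st + k) s)
    ≤⟨ +-monoʳ-≤ (inA A (segment st k)) (inA-segment≤length A (st + k) s) ⟩
      inA A (segment st k) + s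
    ∎
    where open ≤-Reasoning

  inA-segment-slideˡ : ∀ A st s k → inA A (segment st k) ≤ inA A (segment (st + s) k) + s
  inA-segment-slideˡ A st s k = begin
      inA A (segment st k)
    ≤⟨ inA-∪ˡ A _ (segment (st + k) s) ⟩
      inA A (segment st k ∪ segment (st + k) s)
    ≡⟨ cong (inA A) (sym (segment-+ st k s)) ⟩
      inA A (segment st (k + s))
    ≡⟨ cong (λ z → inA A (segment st z)) (+-comm k s) ⟩
      inA A (segment st (s + k))
    ≡⟨ cong (inA A) (segment-+ st s k) ⟩
      inA A (segment st s ∪ segment (st + s) k)
    ≤⟨ inA-∪ A _ _ ⟩
      inA A (segment st s) + inA A (segment (st + s) k)
    ≤⟨ +-monoˡ-≤ _ (inA-segment≤length A st s) ⟩
      s + inA A (segment (st + s) k)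
    ≡⟨ +-comm s _ ⟩
      inA A (segment (st + s) k) + s
    ∎
    where open ≤-Reasoning

  ∑<-segments : ∀ A m s c → (∀ p → f (p + m * s) ≡ f p) → (∀ p p' → p < m * s → p' < m * s → f p ≡ f p' → p ≡ p') →
    ∑< m (λ i → ∑< (c * s) (λ j → inA A ⁅ f (i * s + j) ⁆)) ≤ c * card A
  ∑<-segments A m s c periodic injective = begin
      ∑< m (λ i → ∑< (c * s) (λ j → inA A ⁅ f (i * s + j) ⁆))
    ≡⟨ ∑<-windows-periodic m s c _ (λ p → cong (λ z → inA A ⁅ z ⁆) (periodic p)) ⟩
      c * ∑< (m * s) (λ p → inA A ⁅ f p ⁆)
    ≤⟨ *-monoʳ-≤ c (∑<-inA-injective (m * s) n A f injective) ⟩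
      c * card A
    ∎
    where open ≤-Reasoning

module NoHamiltonCycle where

  open import Data.Nat
  open import Data.Nat.Properties
  open import Data.Nat.DivMod using (_mod_; _%_; [m+n]%n≡m%n; m<n⇒m%n≡m)
  open import Data.Nat.Tactic.RingSolver using (solve-∀)
  open import Data.Bool using (true; false; _∧_)
  open import Data.Bool.Properties using (not-injective)
  open import Data.List using (map; applyUpTo)
  open import Data.Fin using (Fin; toℕ)
  open import Data.Fin.Properties using (fromℕ<-cong; toℕ-fromℕ<)
  open import Data.Fin.Subset using (Subset; ⁅_⁆; ⋃; _∪_; ∁; ∣_∣)
  open import Data.Product using (_,_; proj₁; proj₂)
  open import Data.Sum using (_⊎_; inj₁; inj₂; [_,_]′)
  open import Data.Empty using (⊥)
  open import Relation.Binary.PropositionalEquality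
  open import Relation.Nullary using (¬_; yes; no)
  open import Function using (_∘_)
  open BoundedSums
  open SubsetCounting
  open GapGraph

  inGap-below : ∀ J s a → inGap J s a ≡ false → a < J → a + s < J
  inGap-below J s a a∉gap a<J with J ≤? a + s
  ... | no  J≰a+s = ≰⇒> J≰a+s
  ... | yes J≤a+s with trans (sym (cong₂ _∧_ (T⇒≡true (<⇒<ᵇ a<J)) (T⇒≡true (≤⇒≤ᵇ J≤a+s)))) a∉gap
  ... | ()

  inGap-above : ∀ J s a → inGap J s a ≡ false → J ≤ a + s → J ≤ a
  inGap-above J s a a∉gap J≤a+s with a <? J
  ... | no  a≮J = ≮⇒≥ a≮J
  ... | yes a<J with trans (sym (cong₂ _∧_ (T⇒≡true (<⇒<ᵇ a<J)) (T⇒≡true (≤⇒≤ᵇ J≤a+s)))) a∉gap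
  ... | ()

  gap-uncrossable : ∀ (a : ℕ → ℕ) m J s →
    (∀ i → a (suc i) ≤ a i + s) → (∀ i → a i ≤ a (suc i) + s) → (∀ i → i < m → inGap J s (a i) ≡ false) →
    (∀ i → i < m → a i + s < J) ⊎ (∀ i → i < m → J ≤ a i)
  gap-uncrossable a m J s up down avoids with a 0 + s <? J
  ... | yes a₀+s<J = inj₁ below
    where
    below : ∀ i → i < m → a i + s < J
    below zero    _     = a₀+s<J
    below (suc i) 1+i<m = inGap-below J s (a (suc i)) (avoids (suc i) 1+i<m)
                            (≤-<-trans (up i) (below i (<-trans (n<1+n i) 1+i<m)))
  ... | no a₀+s≮J = inj₂ above
    where
    above : ∀ i → i < m → J ≤ a i
    above zero    0<m   = inGap-above J s (a 0) (avoids 0 0<m) (≮⇒≥ a₀+s≮J)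
    above (suc i) 1+i<m = inGap-above J s (a (suc i)) (avoids (suc i) 1+i<m)
                            (≤-trans (above i (<-trans (n<1+n i) 1+i<m)) (down i))

  -- m edges with at least J vertices in A each, every vertex lying in at most q + 1 edges:
  -- m J ≤ (q + 1) ∣ A ∣ ≤ (q + 1) m s / 2 < m J.
  heavy-edges-impossible : ∀ m s q J a X → 1 ≤ m → m * J ≤ X → X ≤ suc q * a → 2 * a ≤ m * s → suc q * s < 2 * J → ⊥
  heavy-edges-impossible m@(suc _) s q J a X _ mJ≤X X≤[1+q]a 2a≤ms [1+q]s<2J = <-irrefl refl (begin-strict
    m * (suc q * s)   <⟨ *-monoʳ-< m [1+q]s<2J ⟩
    m * (2 * J)       ≡⟨ swap m 2 J ⟩
    2 * (m * J)       ≤⟨ *-monoʳ-≤ 2 (≤-trans mJ≤X X≤[1+q]a) ⟩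
    2 * (suc q * a)   ≡⟨ swap 2 (suc q) a ⟩
    suc q * (2 * a)   ≤⟨ *-monoʳ-≤ (suc q) 2a≤ms ⟩
    suc q * (m * s)   ≡⟨ swap (suc q) m s ⟩
    m * (suc q * s)   ∎)
    where
    open ≤-Reasoning
    swap : ∀ x y z → x * (y * z) ≡ y * (x * z)
    swap = solve-∀

  -- Light edges (fewer than J - s vertices in A) have more than k + s - J vertices outside A; bounding these
  -- by q ∣ ∁ A ∣ + m r, with 2 ∣ ∁ A ∣ ≤ m s + 1, forces m s ≤ q.
  light-edges-impossible : ∀ m s q J r a̅ Sa Sb k → k ≡ q * s + r → Sa + Sb ≡ m * k → Sb ≤ q * a̅ + m * r →
    2 * a̅ ≤ suc (m * s) → Sa + m * suc s ≤ m * J → 2 * J ≤ suc q * s + 2 → q < m * s → ⊥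
  light-edges-impossible m s q J r a̅ Sa Sb k k≡qs+r Sa+Sb≡mk Sb≤ 2a̅≤1+ms Sa+m[1+s]≤mJ 2J≤[1+q]s+2 q<ms =
    <⇒≱ q<ms (+-cancelʳ-≤ R (m * s) q (begin
      m * s + R                                               ≡⟨ expand₁ m q s r ⟩
      2 * (m * (q * s + r)) + 2 * (m * suc s)                 ≡⟨ cong (λ z → 2 * (m * z) + 2 * (m * suc s)) (sym k≡qs+r) ⟩
      2 * (m * k) + 2 * (m * suc s)                           ≡⟨ cong (λ z → 2 * z + 2 * (m * suc s)) (sym Sa+Sb≡mk) ⟩
      2 * (Sa + Sb) + 2 * (m * suc s)                         ≤⟨ +-monoˡ-≤ _ (*-monoʳ-≤ 2 (+-monoʳ-≤ Sa Sb≤)) ⟩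
      2 * (Sa + (q * a̅ + m * r)) + 2 * (m * suc s)            ≡⟨ regroup Sa q a̅ m r s ⟩
      2 * (Sa + m * suc s) + q * (2 * a̅) + 2 * (m * r)        ≤⟨ +-monoˡ-≤ _ (+-mono-≤ (*-monoʳ-≤ 2 Sa+m[1+s]≤mJ)
                                                                                     (*-monoʳ-≤ q 2a̅≤1+ms)) ⟩
      2 * (m * J) + q * suc (m * s) + 2 * (m * r)             ≡⟨ cong (λ z → z + q * suc (m * s) + 2 * (m * r)) (swap 2 m J) ⟩
      m * (2 * J) + q * suc (m * s) + 2 * (m * r)             ≤⟨ +-monoˡ-≤ _ (+-monoˡ-≤ _ (*-monoʳ-≤ m 2J≤[1+q]s+2)) ⟩
      m * (suc q * s + 2) + q * suc (m * s) + 2 * (m * r)     ≡⟨ expand₂ m q s r ⟩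
      q + R                                                   ∎))
    where
    open ≤-Reasoning
    R : ℕ
    R = 2 * (m * (q * s)) + 2 * (m * r) + m * s + 2 * m
    expand₁ : ∀ m q s r → m * s + (2 * (m * (q * s)) + 2 * (m * r) + m * s + 2 * m) ≡ 2 * (m * (q * s + r)) + 2 * (m * suc s)
    expand₁ = solve-∀
    expand₂ : ∀ m q s r → m * (suc q * s + 2) + q * suc (m * s) + 2 * (m * r) ≡ q + (2 * (m * (q * s)) + 2 * (m * r) + m * s + 2 * m)
    expand₂ = solve-∀
    regroup : ∀ Sa q a̅ m r s → 2 * (Sa + (q * a̅ + m * r)) + 2 * (m * suc s) ≡ 2 * (Sa + m * suc s) + q * (2 * a̅) + 2 * (m * r)
    regroup = solve-∀
    swap : ∀ x y z → x * (y * z) ≡ y * (x * z)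
    swap = solve-∀

  ⋃-map-applyUpTo : ∀ {n} (h : ℕ → Subset n) (g : ℕ → ℕ) l → ⋃ (map h (applyUpTo g l)) ≡ ⋃< (h ∘ g) l
  ⋃-map-applyUpTo h g zero    = refl
  ⋃-map-applyUpTo h g (suc l) = cong (h (g 0) ∪_) (⋃-map-applyUpTo h (g ∘ suc) l)

  mod-periodic : ∀ n′ p → (p + suc n′) mod suc n′ ≡ p mod suc n′
  mod-periodic n′ p = fromℕ<-cong _ _ ([m+n]%n≡m%n p (suc n′)) _ _

  mod-injective : ∀ n′ {p p′} → p < suc n′ → p′ < suc n′ → p mod suc n′ ≡ p′ mod suc n′ → p ≡ p′
  mod-injective n′ {p} {p′} p<n p′<n p≡p′[mod] = begin
    p                    ≡⟨ sym (m<n⇒m%n≡m p<n) ⟩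
    p % suc n′           ≡⟨ sym (toℕ-fromℕ< _) ⟩
    toℕ (p mod suc n′)   ≡⟨ cong toℕ p≡p′[mod] ⟩
    toℕ (p′ mod suc n′)  ≡⟨ toℕ-fromℕ< _ ⟩
    p′ % suc n′          ≡⟨ m<n⇒m%n≡m p′<n ⟩
    p′                   ∎
    where open ≡-Reasoning

  gapGraph-nonHamiltonian : ∀ n′ k ℓ J q r (A : Subset (suc n′)) →
    k ≡ q * (k ∸ ℓ) + r → r < k ∸ ℓ →
    2 * card A ≤ suc n′ → 2 * card (∁ A) ≤ suc (suc n′) →
    suc q * (k ∸ ℓ) < 2 * J → 2 * J ≤ suc q * (k ∸ ℓ) + 2 → q < suc n′ →
    ¬ HamiltonCycle k ℓ (gapGraph J (k ∸ ℓ) A)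
  gapGraph-nonHamiltonian n′ k ℓ J q r A k≡qs+r r<s 2∣A∣≤n 2∣∁A∣≤1+n [1+q]s<2J 2J≤[1+q]s+2 q<n
                          (σ , σ-injective , m , ms≡n , edges) =
    [ allLight , allHeavy ]′ (gap-uncrossable a m J s slideʳ slideˡ avoids)
    where
    n s : ℕ
    n = suc n′
    s = k ∸ ℓ
    f : ℕ → Fin n
    f p = σ (p mod n)
    open Segments f
    window≡segment : ∀ st → window σ st k ≡ segment st k
    window≡segment st = ⋃-map-applyUpTo (λ j → ⁅ σ ((st + j) mod n) ⁆) (λ j → j) k
    a a̅ : ℕ → ℕ
    a i = inA A (segment (i * s) k)
    a̅ i = inA (∁ A) (segment (i * s) k)
    avoids : ∀ i → i < m → inGap J s (a i) ≡ false
    avoids i i<m = not-injective (subst (λ e → gapGraph J s A e ≡ true) (window≡segment (i * s)) (proj₂ (proj₁ (edges i i<m))))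
    a+a̅≡k : ∀ i → i < m → a i + a̅ i ≡ k
    a+a̅≡k i i<m = begin
      a i + a̅ i                   ≡⟨ inA+inA∁≡card A (segment (i * s) k) ⟩
      card (segment (i * s) k)    ≡⟨ sym (∣∣≡card (segment (i * s) k)) ⟩
      ∣ segment (i * s) k ∣       ≡⟨ subst (λ e → ∣ e ∣ ≡ k) (window≡segment (i * s)) (proj₁ (proj₁ (edges i i<m))) ⟩
      k                           ∎
      where open ≡-Reasoning
    a[1+i]≡ : ∀ i → a (suc i) ≡ inA A (segment (i * s + s) k)
    a[1+i]≡ i = cong (λ z → inA A (segment z k)) (+-comm s (i * s))
    slideʳ : ∀ i → a (suc i) ≤ a i + s
    slideʳ i = subst (_≤ a i + s) (sym (a[1+i]≡ i)) (inA-segment-slideʳ A (i * s) s k)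
    slideˡ : ∀ i → a i ≤ a (suc i) + s
    slideˡ i = subst (λ z → a i ≤ z + s) (sym (a[1+i]≡ i)) (inA-segment-slideˡ A (i * s) s k)
    f-periodic : ∀ p → f (p + m * s) ≡ f p
    f-periodic p rewrite ms≡n = cong σ (mod-periodic n′ p)
    f-injective : ∀ p p′ → p < m * s → p′ < m * s → f p ≡ f p′ → p ≡ p′
    f-injective p p′ p<ms p′<ms = mod-injective n′ (subst (p <_) ms≡n p<ms) (subst (p′ <_) ms≡n p′<ms) ∘ σ-injective
    k≤[1+q]s : k ≤ suc q * s
    k≤[1+q]s = subst (_≤ suc q * s) (sym k≡qs+r) (subst (q * s + r ≤_) (+-comm (q * s) s) (+-monoʳ-≤ (q * s) (<⇒≤ r<s)))
    ∑a≤ : ∑< m a ≤ suc q * card A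
    ∑a≤ = ≤-trans (∑<-mono-≤ m (λ i _ → ≤-trans (inA-segment A (i * s) k) (∑<-monoˡ-≤ _ k≤[1+q]s)))
                  (∑<-segments A m s (suc q) f-periodic f-injective)
    a̅≤ : ∀ i → a̅ i ≤ ∑< (q * s) (λ j → inA (∁ A) ⁅ f (i * s + j) ⁆) + r
    a̅≤ i = subst (λ l → inA (∁ A) (segment (i * s) l) ≤ ∑< (q * s) (λ j → inA (∁ A) ⁅ f (i * s + j) ⁆) + r) (sym k≡qs+r)
                 (inA-segment-+ (∁ A) (i * s) (q * s) r)
    ∑a̅≤ : ∑< m a̅ ≤ q * card (∁ A) + m * r
    ∑a̅≤ = begin
        ∑< m a̅
      ≤⟨ ∑<-mono-≤ m (λ i _ → a̅≤ i) ⟩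
        ∑< m (λ i → ∑< (q * s) (λ j → inA (∁ A) ⁅ f (i * s + j) ⁆) + r)
      ≡⟨ ∑<-distrib-+ m _ _ ⟩
        ∑< m (λ i → ∑< (q * s) (λ j → inA (∁ A) ⁅ f (i * s + j) ⁆)) + ∑< m (λ _ → r)
      ≤⟨ +-mono-≤ (∑<-segments (∁ A) m s q f-periodic f-injective) (≤-reflexive (∑<-const m r)) ⟩
        q * card (∁ A) + m * r
      ∎
      where open ≤-Reasoning
    ∑a+∑a̅≡mk : ∑< m a + ∑< m a̅ ≡ m * k
    ∑a+∑a̅≡mk = trans (sym (∑<-distrib-+ m a a̅)) (trans (∑<-cong m a+a̅≡k) (∑<-const m k))
    1≤m : 1 ≤ m
    1≤m = n≢0⇒n>0 (λ m≡0 → 0≢1+n (trans (cong (_* s) (sym m≡0)) ms≡n))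
    allLight : (∀ i → i < m → a i + s < J) → ⊥
    allLight light = light-edges-impossible m s q J r (card (∁ A)) (∑< m a) (∑< m a̅) k k≡qs+r ∑a+∑a̅≡mk ∑a̅≤
      (subst (λ z → 2 * card (∁ A) ≤ suc z) (sym ms≡n) 2∣∁A∣≤1+n) ∑a+m[1+s]≤mJ 2J≤[1+q]s+2 (subst (q <_) (sym ms≡n) q<n)
      where
      ∑a+m[1+s]≤mJ : ∑< m a + m * suc s ≤ m * J
      ∑a+m[1+s]≤mJ = begin
        ∑< m a + m * suc s          ≡⟨ sym (trans (∑<-distrib-+ m a (λ _ → suc s)) (cong (∑< m a +_) (∑<-const m (suc s)))) ⟩
        ∑< m (λ i → a i + suc s)    ≤⟨ ∑<-mono-≤ m (λ i i<m → subst (_≤ J) (sym (+-suc (a i) s)) (light i i<m)) ⟩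
        ∑< m (λ _ → J)              ≡⟨ ∑<-const m J ⟩
        m * J                       ∎
        where open ≤-Reasoning
    allHeavy : (∀ i → i < m → J ≤ a i) → ⊥
    allHeavy heavy = heavy-edges-impossible m s q J (card A) (∑< m a) 1≤m
      (subst (_≤ ∑< m a) (∑<-const m J) (∑<-mono-≤ m heavy)) ∑a≤ (subst (2 * card A ≤_) (sym ms≡n) 2∣A∣≤n) [1+q]s<2J

module Alternating where

  open import Data.Nat
  open import Data.Nat.Properties
  open import Data.Nat.Tactic.RingSolver using (solve-∀)
  open import Data.Bool using (Bool; true; false; not)
  open import Data.Vec using ([]; _∷_)
  open import Data.Fin.Subset using (Subset; ∁)
  open import Relation.Binary.PropositionalEquality
  open SubsetCounting

  alternating : Bool → (n : ℕ) → Subset n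
  alternating b zero    = []
  alternating b (suc n) = b ∷ alternating (not b) n

  ∁-alternating : ∀ b n → ∁ (alternating b n) ≡ alternating (not b) n
  ∁-alternating b zero    = refl
  ∁-alternating b (suc n) = cong (not b ∷_) (∁-alternating (not b) n)

  2*card-alternating : ∀ b n → 2 * card (alternating b n) ≤ n + 𝟙 b
  2*card-alternating b     zero    = z≤n
  2*card-alternating false (suc n) = begin
    2 * card (alternating true n)  ≤⟨ 2*card-alternating true n ⟩
    n + 1                          ≡⟨ shift n ⟩
    suc n + 0                      ∎
    where
    open ≤-Reasoning
    shift : ∀ n → n + 1 ≡ suc n + 0
    shift = solve-∀
  2*card-alternating true  (suc n) = begin
    2 * (1 + card (alternating false n))  ≡⟨ *-distribˡ-+ 2 1 _ ⟩
    2 + 2 * card (alternating false n)    ≤⟨ +-monoʳ-≤ 2 (2*card-alternating false n) ⟩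
    2 + (n + 0)                           ≡⟨ shift n ⟩
    suc n + 1                             ∎
    where
    open ≤-Reasoning
    shift : ∀ n → 2 + (n + 0) ≡ suc n + 1
    shift = solve-∀

module ThresholdArithmetic where

  open import Data.Nat
  open import Data.Nat.Properties
  open import Data.Nat.Tactic.RingSolver using (solve-∀)
  open import Relation.Binary.PropositionalEquality
  open import Relation.Nullary using (¬_)

  -- Used with p = 2 ^ t, E = e + 1, F = t!, Cₙ = C(n, t), Cₓ = C(n - d, t), β = b(t, k - ℓ), Z = (n + 1) ^ t
  -- and Y = (n + 1 - k) ^ t: then Cₙ F, Cₓ F, Z and Y agree up to a factor 1 + 1 / (E (p + β)), and the
  -- codegree bound D ≥ Cₓ - β Z / (F p) beats every h violating the inequality of the theorem.
  below-codegree : ∀ h D Cₙ Cₓ F p E β Z Y →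
    Cₓ * (F * p) ≤ D * (F * p) + β * Z →
    Cₙ * F ≤ Z → Y ≤ Cₙ * F → Y ≤ Cₓ * F → 1 ≤ F → 1 ≤ p → 1 ≤ E →
    (E * (p + β)) * Z ≤ (E * (p + β)) * Y + Y →
    ¬ (p * E * Cₙ ≤ h * p * E + p * Cₙ + β * E * Cₙ) →
    h ≤ D
  below-codegree h D Cₙ Cₓ F p E β Z Y codegree Cₙ≤Z Y≤Cₙ Y≤Cₓ 1≤F 1≤p 1≤E Z≈Y violated =
    *-cancelʳ-≤ h D W {{>-nonZero (*-mono-≤ (*-mono-≤ 1≤p 1≤E) 1≤F)}} (+-cancelʳ-≤ (E * β * Z) _ _ (begin
        h * W + E * β * Z                    ≤⟨ h-bound ⟩
        p * E * (Cₓ * F)                     ≡⟨ regroup₁ p E Cₓ F ⟩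
        E * (Cₓ * (F * p))                   ≤⟨ *-monoʳ-≤ E codegree ⟩
        E * (D * (F * p) + β * Z)            ≡⟨ regroup₂ E D F p β Z ⟩
        D * W + E * β * Z                    ∎))
    where
    open ≤-Reasoning
    W P : ℕ
    W = p * E * F
    P = Cₙ * F
    violated′ : h * W + p * P + β * E * P ≤ p * E * P
    violated′ = begin
        h * W + p * P + β * E * P                 ≡⟨ factor h p E F Cₙ β ⟩
        (h * p * E + p * Cₙ + β * E * Cₙ) * F     ≤⟨ *-monoˡ-≤ F (<⇒≤ (≰⇒> violated)) ⟩
        p * E * Cₙ * F                            ≡⟨ *-assoc (p * E) Cₙ F ⟩
        p * E * P                                 ∎
      where
      factor : ∀ h p E F Cₙ β → h * (p * E * F) + p * (Cₙ * F) + β * E * (Cₙ * F) ≡ (h * p * E + p * Cₙ + β * E * Cₙ) * F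
      factor = solve-∀
    estimates : p * E * P + E * β * Z ≤ p * P + β * E * P + p * E * (Cₓ * F)
    estimates = begin
        p * E * P + E * β * Z                     ≤⟨ +-monoˡ-≤ _ (*-monoʳ-≤ (p * E) Cₙ≤Z) ⟩
        p * E * Z + E * β * Z                     ≡⟨ collect p E β Z ⟩
        (E * (p + β)) * Z                         ≤⟨ Z≈Y ⟩
        (E * (p + β)) * Y + Y                     ≤⟨ +-monoʳ-≤ _ (subst (_≤ p * Y) (*-identityˡ Y) (*-monoˡ-≤ Y 1≤p)) ⟩
        (E * (p + β)) * Y + p * Y                 ≡⟨ spread p E β Y ⟩
        p * Y + β * E * Y + p * E * Y             ≤⟨ +-mono-≤ (+-mono-≤ (*-monoʳ-≤ p Y≤Cₙ) (*-monoʳ-≤ (β * E) Y≤Cₙ))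
                                                               (*-monoʳ-≤ (p * E) Y≤Cₓ) ⟩
        p * P + β * E * P + p * E * (Cₓ * F)      ∎
      where
      collect : ∀ p E β Z → p * E * Z + E * β * Z ≡ (E * (p + β)) * Z
      collect = solve-∀
      spread : ∀ p E β Y → (E * (p + β)) * Y + p * Y ≡ p * Y + β * E * Y + p * E * Y
      spread = solve-∀
    h-bound : h * W + E * β * Z ≤ p * E * (Cₓ * F)
    h-bound = +-cancelˡ-≤ (p * P + β * E * P) _ _ (begin
        p * P + β * E * P + (h * W + E * β * Z)   ≡⟨ shuffle (p * P) (β * E * P) (h * W) (E * β * Z) ⟩
        (h * W + p * P + β * E * P) + E * β * Z   ≤⟨ +-monoˡ-≤ _ violated′ ⟩
        p * E * P + E * β * Z                     ≤⟨ estimates ⟩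
        p * P + β * E * P + p * E * (Cₓ * F)      ∎)
      where
      shuffle : ∀ a b c d → a + b + (c + d) ≡ c + a + b + d
      shuffle = solve-∀
    regroup₁ : ∀ p E Cₓ F → p * E * (Cₓ * F) ≡ E * (Cₓ * (F * p))
    regroup₁ = solve-∀
    regroup₂ : ∀ E D F p β Z → E * (D * (F * p) + β * Z) ≡ D * (p * E * F) + E * β * Z
    regroup₂ = solve-∀

module Construction (d ℓ k : ℕ) (d≤ℓ : d ≤ ℓ) (ℓ<k : suc ℓ ≤ k) where

  open import Data.Nat
  open import Data.Nat.Properties
  open import Data.Nat.DivMod using (_/_; _%_; m≡m%n+[m/n]*n; m%n<n; m/n≤m)
  open import Data.Bool using (false; true)
  open import Data.Fin.Subset using (Subset; ∣_∣)
  open import Relation.Binary.PropositionalEquality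
  open import Relation.Nullary using (¬_)
  open import Data.Nat.Tactic.RingSolver using (solve-∀)
  open FallingFactorial
  open SubsetCounting
  open GapGraph
  open NoHamiltonCycle
  open Alternating

  2+y*2≡2[y+1] : ∀ y → 2 + y * 2 ≡ 2 * (y + 1)
  2+y*2≡2[y+1] = solve-∀

  s t : ℕ
  s = k ∸ ℓ
  t = k ∸ d

  1≤s : 1 ≤ s
  1≤s = m<n⇒0<n∸m ℓ<k

  s≤t : s ≤ t
  s≤t = ∸-monoʳ-≤ k d≤ℓ

  d≤k : d ≤ k
  d≤k = ≤-trans d≤ℓ (≤-trans (n≤1+n ℓ) ℓ<k)

  t≤k : t ≤ k
  t≤k = m∸n≤m k d

  1≤t : 1 ≤ t
  1≤t = ≤-trans 1≤s s≤t

  instance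
    s≢0 : NonZero s
    s≢0 = >-nonZero 1≤s

  q gapEnd : ℕ
  q = k / s
  gapEnd = suc q * s / 2 + 1

  x<2[x/2+1] : ∀ x → x < 2 * (x / 2 + 1)
  x<2[x/2+1] x = begin-strict
    x                      ≡⟨ m≡m%n+[m/n]*n x 2 ⟩
    x % 2 + x / 2 * 2      <⟨ +-monoˡ-< (x / 2 * 2) (m%n<n x 2) ⟩
    2 + x / 2 * 2          ≡⟨ 2+y*2≡2[y+1] (x / 2) ⟩
    2 * (x / 2 + 1)        ∎
    where open ≤-Reasoning

  2[x/2+1]≤x+2 : ∀ x → 2 * (x / 2 + 1) ≤ x + 2
  2[x/2+1]≤x+2 x = begin
    2 * (x / 2 + 1)        ≡⟨ sym (2+y*2≡2[y+1] (x / 2)) ⟩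
    2 + x / 2 * 2          ≤⟨ +-monoʳ-≤ 2 (m≤n+m (x / 2 * 2) (x % 2)) ⟩
    2 + (x % 2 + x / 2 * 2) ≡⟨ cong (2 +_) (sym (m≡m%n+[m/n]*n x 2)) ⟩
    2 + x                  ≡⟨ +-comm 2 x ⟩
    x + 2                  ∎
    where open ≤-Reasoning

  H : (n : ℕ) → KGraph n
  H n = gapGraph gapEnd s (alternating false n)

  H-nonHamiltonian : ∀ n → k < n → ¬ HamiltonCycle k ℓ (H n)
  H-nonHamiltonian (suc n) k<1+n = gapGraph-nonHamiltonian n k ℓ gapEnd q (k % s) (alternating false (suc n))
    (trans (m≡m%n+[m/n]*n k s) (+-comm (k % s) (q * s))) (m%n<n k s)
    (≤-trans (2*card-alternating false (suc n)) (≤-reflexive (+-identityʳ (suc n))))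
    (subst (λ A → 2 * card A ≤ suc (suc n)) (sym (∁-alternating false (suc n)))
      (≤-trans (2*card-alternating true (suc n)) (≤-reflexive (+-comm (suc n) 1))))
    (x<2[x/2+1] (suc q * s)) (2[x/2+1]≤x+2 (suc q * s)) (≤-<-trans (m/n≤m k s) k<1+n)

  H-codegree : ∀ n (S : Subset n) → ∣ S ∣ ≡ d →
    ((n ∸ d) C t) * (t ! * 2 ^ t) ≤ deg k (H n) S * (t ! * 2 ^ t) + b t s * suc n ^ t
  H-codegree n S ∣S∣≡d = subst (λ x → (x C t) * (t ! * 2 ^ t) ≤ deg k (H n) S * (t ! * 2 ^ t) + b t s * suc n ^ t) free≡n∸d
    (codegree-gapGraph n k t s gapEnd (suc n) A S k≡∣S∣+t s≤t 2freeIn≤1+n 2freeOut≤1+n)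
    where
    A : Subset n
    A = alternating false n
    card≡d : card S ≡ d
    card≡d = trans (sym (∣∣≡card S)) ∣S∣≡d
    k≡∣S∣+t : k ≡ card S + t
    k≡∣S∣+t = trans (sym (m+[n∸m]≡n d≤k)) (cong (_+ t) (sym card≡d))
    free≡n∸d : free S ≡ n ∸ d
    free≡n∸d = trans (sym (m+n∸m≡n (card S) (free S))) (cong₂ _∸_ (card+free≡n S) card≡d)
    2freeIn≤1+n : 2 * freeIn S A ≤ suc n
    2freeIn≤1+n = ≤-trans (*-monoʳ-≤ 2 (freeIn≤card S A))
      (≤-trans (2*card-alternating false n) (≤-trans (≤-reflexive (+-identityʳ n)) (n≤1+n n)))
    2freeOut≤1+n : 2 * freeOut S A ≤ suc n
    2freeOut≤1+n = ≤-trans (*-monoʳ-≤ 2 (subst (λ B → freeOut S A ≤ card B) (∁-alternating false n) (freeOut≤card∁ S A)))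
      (≤-trans (2*card-alternating true n) (≤-reflexive (+-comm n 1)))

  [1+n∸k]^t≤ : ∀ m n → suc n ∸ k ≤ suc m ∸ t → (suc n ∸ k) ^ t ≤ (m C t) * t !
  [1+n∸k]^t≤ m n le = ≤-trans (^-monoˡ-≤ t le) ([1+n∸k]^k≤falling m t)

  nCt*t!≤[1+n]^t : ∀ n → (n C t) * t ! ≤ suc n ^ t
  nCt*t!≤[1+n]^t n = ≤-trans (falling≤^ n t) (^-monoˡ-≤ t (n≤1+n n))

  [1+n∸k]^t≤nCt*t! : ∀ n → (suc n ∸ k) ^ t ≤ (n C t) * t !
  [1+n∸k]^t≤nCt*t! n = [1+n∸k]^t≤ n n (∸-monoʳ-≤ (suc n) t≤k)

  [1+n∸k]^t≤[n∸d]Ct*t! : ∀ n → (suc n ∸ k) ^ t ≤ ((n ∸ d) C t) * t !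
  [1+n∸k]^t≤[n∸d]Ct*t! n = [1+n∸k]^t≤ (n ∸ d) n (begin
      suc n ∸ k            ≡⟨ cong (suc n ∸_) (sym (m+[n∸m]≡n d≤k)) ⟩
      suc n ∸ (d + t)      ≡⟨ sym (∸-+-assoc (suc n) d t) ⟩
      suc n ∸ d ∸ t        ≤⟨ ∸-monoˡ-≤ t ([1+m]∸n≤1+[m∸n] n d) ⟩
      suc (n ∸ d) ∸ t      ∎)
    where
    open ≤-Reasoning
    [1+m]∸n≤1+[m∸n] : ∀ m n → suc m ∸ n ≤ suc (m ∸ n)
    [1+m]∸n≤1+[m∸n] m       zero    = ≤-refl
    [1+m]∸n≤1+[m∸n] zero    (suc n) = ≤-trans (≤-reflexive (0∸n≡0 n)) z≤n
    [1+m]∸n≤1+[m∸n] (suc m) (suc n) = [1+m]∸n≤1+[m∸n] m n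

  K*[1+n]^t≤K*[1+n∸k]^t+[1+n∸k]^t : ∀ K n → K * k * t + k * t + suc k ≤ n → K * suc n ^ t ≤ K * (suc n ∸ k) ^ t + (suc n ∸ k) ^ t
  K*[1+n]^t≤K*[1+n∸k]^t+[1+n∸k]^t K n N≤n = subst (λ z → K * z ^ t ≤ K * (suc n ∸ k) ^ t + (suc n ∸ k) ^ t) [1+n∸k]+k≡1+n
    (^-shift-≤ K (suc n ∸ k) k t 1≤t
      (subst (K * k * t + k * t ≤_) (sym [1+n∸k]+k≡1+n) (≤-trans (m≤m+n _ (suc k)) (≤-trans N≤n (n≤1+n n)))))
    where
    [1+n∸k]+k≡1+n : suc n ∸ k + k ≡ suc n
    [1+n∸k]+k≡1+n = m∸n+n≡m (≤-trans (<⇒≤ (m+n≤o⇒n≤o (K * k * t + k * t) N≤n)) (n≤1+n n))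

open ThresholdArithmetic

theorem1p5 : (d ℓ k : ℕ) → 1 ≤ d → d ≤ ℓ → suc ℓ ≤ k →
    (e : ℕ) → Σ ℕ λ N → (n : ℕ) → N ≤ n → (k ∸ ℓ) ∣ n →
      (h : ℕ) → ((H : KGraph n) → MinDegAtLeast k d H h → HamiltonCycle k ℓ H) →
      2 ^ (k ∸ d) * suc e * (n C (k ∸ d))
        ≤ h * 2 ^ (k ∸ d) * suc e + 2 ^ (k ∸ d) * (n C (k ∸ d)) + b (k ∸ d) (k ∸ ℓ) * suc e * (n C (k ∸ d))
theorem1p5 d ℓ k _ d≤ℓ ℓ<k e = N , bound
  where
  open Construction d ℓ k d≤ℓ ℓ<k
  K N : ℕ
  K = suc e * (2 ^ t + b t s)
  N = K * k * t + k * t + suc k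
  bound : (n : ℕ) → N ≤ n → s ∣ n → (h : ℕ) → ((G : KGraph n) → MinDegAtLeast k d G h → HamiltonCycle k ℓ G) →
    2 ^ t * suc e * (n C t) ≤ h * 2 ^ t * suc e + 2 ^ t * (n C t) + b t s * suc e * (n C t)
  bound n N≤n _ h threshold with 2 ^ t * suc e * (n C t) ≤? h * 2 ^ t * suc e + 2 ^ t * (n C t) + b t s * suc e * (n C t)
  ... | yes holds   = holds
  ... | no violated = ⊥-elim (H-nonHamiltonian n (m+n≤o⇒n≤o (K * k * t + k * t) N≤n) (threshold (H n) λ S ∣S∣≡d →
    below-codegree h (deg k (H n) S) (n C t) ((n ∸ d) C t) (t !) (2 ^ t) (suc e) (b t s) (suc n ^ t) ((suc n ∸ k) ^ t)
      (H-codegree n S ∣S∣≡d) (nCt*t!≤[1+n]^t n) ([1+n∸k]^t≤nCt*t! n) ([1+n∸k]^t≤[n∸d]Ct*t! n)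
      (1≤n! t) (m^n>0 2 t) (s≤s z≤n) (K*[1+n]^t≤K*[1+n∸k]^t+[1+n∸k]^t K n N≤n) violated))
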